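{- Let $n\geqslant2$ and let $r_1<r_2<\cdots<r_n$ be positive integers. Then $$\varphi\big(C(r_1, \ldots, r_n)\big)=\varphi^{r_n-r_{n-1}}\big(C(r_1, \ldots, r_{n-1})\big)\varphi\big(C(r_1, \ldots, r_{n-2})\big)\frac{x^2-r_n}{x^2-r_{n-1}}.$$
   Context: For a graph $G$, $\varphi(G)=\varphi(G;x)$ denotes the characteristic polynomial of its adjacency matrix. For a positive integer $m$ and rooted trees $T_1, T_2$ with disjoint vertex sets, $T_1\sim mT_2$ denotes the rooted tree obtained from $T_1$ and $m$ copies of $T_2$ by joining the root of $T_1$ to the roots of the copies of $T_2$, with the root of $T_1$ as root. For positive integers $r_1<r_2<\cdots<r_n$, the rooted tree $C(r_1,\ldots,r_n)$ is defined recursively by $C(r_1, \ldots, r_n)=C(r_1, \ldots, r_{n-2})\sim (r_n-r_{n-1})C(r_1, \ldots, r_{n-1})$ for $n\geqslant 2$, where $C(\,)$ is the one-vertex tree and $C(r_1)$ is the star on $r_1+1$ vertices (rooted at its center). -}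

module Defs where

open import Data.Nat using (ℕ; zero; suc; _+_; _∸_; _≡ᵇ_)
open import Data.Integer as ℤ using (ℤ; +_; -_)
open import Data.Fin using (Fin; zero; suc; toℕ; punchIn)
open import Data.List using (List; []; _∷_; _++_; map; replicate)
open import Data.Bool.ListAction using (any)
open import Data.Product using (_×_; _,_)
open import Data.Bool using (Bool; true; false; if_then_else_; _∧_; _∨_)

-- Polynomials in x with integer coefficients: coefficient lists,
-- lowest degree first.  Equality is coefficientwise (so trailing zeros
-- are irrelevant).

Poly : Set
Poly = List ℤ

coeff : Poly → ℕ → ℤ
coeff []      _       = + 0
coeff (a ∷ p) zero    = a
coeff (a ∷ p) (suc i) = coeff p i

infix 4 _≈ₚ_
_≈ₚ_ : Poly → Poly → Set
p ≈ₚ q = ∀ i → coeff p i ≡ coeff q i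
  where open import Relation.Binary.PropositionalEquality using (_≡_)

infixl 6 _+ₚ_
_+ₚ_ : Poly → Poly → Poly
[]      +ₚ q       = q
(a ∷ p) +ₚ []      = a ∷ p
(a ∷ p) +ₚ (b ∷ q) = (a ℤ.+ b) ∷ (p +ₚ q)

negₚ : Poly → Poly
negₚ = map (-_)

scaleₚ : ℤ → Poly → Poly
scaleₚ a = map (a ℤ.*_)

infixl 7 _*ₚ_
_*ₚ_ : Poly → Poly → Poly
[]      *ₚ q = []
(a ∷ p) *ₚ q = scaleₚ a q +ₚ (+ 0 ∷ (p *ₚ q))

constₚ : ℤ → Poly
constₚ a = a ∷ []

1ₚ : Poly
1ₚ = constₚ (+ 1)

X : Poly
X = + 0 ∷ + 1 ∷ []

infixr 8 _^ₚ_
_^ₚ_ : Poly → ℕ → Poly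
p ^ₚ zero  = 1ₚ
p ^ₚ suc k = p *ₚ (p ^ₚ k)

sumₚ : (n : ℕ) → (Fin n → Poly) → Poly
sumₚ zero    f = []
sumₚ (suc n) f = f zero +ₚ sumₚ n (λ j → f (suc j))

signₚ : ℕ → Poly
signₚ zero          = 1ₚ
signₚ (suc zero)    = constₚ (- (+ 1))
signₚ (suc (suc k)) = signₚ k

det : (n : ℕ) → (Fin n → Fin n → Poly) → Poly
det zero    M = 1ₚ
det (suc n) M =
  sumₚ (suc n) (λ j → signₚ (toℕ j) *ₚ M zero j
                        *ₚ det n (λ i k → M (suc i) (punchIn j k)))

charPoly : (n : ℕ) → (Fin n → Fin n → ℤ) → Poly
charPoly n A =
  det n (λ i j → (if toℕ i ≡ᵇ toℕ j then X else []) +ₚ negₚ (constₚ (A i j)))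

data RTree : Set where
  node : List RTree → RTree

leaf : RTree
leaf = node []

mutual
  size : RTree → ℕ
  size (node ts) = suc (sizes ts)

  sizes : List RTree → ℕ
  sizes []       = 0
  sizes (t ∷ ts) = size t + sizes ts

-- Vertices of a tree are numbered 0 … size-1 in preorder, starting at
-- offset o (the root gets number o).  edges t o lists the edges.
mutual
  edges : RTree → ℕ → List (ℕ × ℕ)
  edges (node ts) o = forestEdges ts o (suc o)

  -- subtrees of a vertex p, the first one rooted at offset o
  forestEdges : List RTree → ℕ → ℕ → List (ℕ × ℕ)
  forestEdges []       p o = []
  forestEdges (t ∷ ts) p o = (p , o) ∷ (edges t o ++ forestEdges ts p (o + size t))

adjacentᵇ : List (ℕ × ℕ) → ℕ → ℕ → Bool
adjacentᵇ es a b =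
  any (λ { (i , j) → ((i ≡ᵇ a) ∧ (j ≡ᵇ b)) ∨ ((i ≡ᵇ b) ∧ (j ≡ᵇ a)) }) es

adjMatrix : (t : RTree) → Fin (size t) → Fin (size t) → ℤ
adjMatrix t i j = if adjacentᵇ (edges t 0) (toℕ i) (toℕ j) then + 1 else + 0

φ : RTree → Poly
φ t = charPoly (size t) (adjMatrix t)

infixl 5 _∼_·_
_∼_·_ : RTree → ℕ → RTree → RTree
node ts ∼ m · t₂ = node (ts ++ replicate m t₂)

star : ℕ → RTree
star r = node (replicate r leaf)

-- C r k = C(r 1, …, r k)  (sequence r is 1-indexed; r 0 is unused)
C : (ℕ → ℕ) → ℕ → RTree
C r zero          = leaf
C r (suc zero)    = star (r 1)
C r (suc (suc k)) = C r k ∼ (r (suc (suc k)) ∸ r (suc k)) · C r (suc k)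

x²- : ℕ → Poly
x²- c = X *ₚ X +ₚ negₚ (constₚ (+ c))

-- Expanding det(xI − A) along the row of the root shows that deleting the edge from the root of
-- T = node (t ∷ ts) to t gives φ(T) = φ(t) φ(node ts) − π(t) π(node ts), where π(S) = φ(S − root)
-- is the product of the characteristic polynomials of the subtrees of S. Iterating, a join
-- T = T₁ ∼ m T₂ satisfies π(T) = π(T₁) φ(T₂)^m and
--   φ(T) = φ(T₂)^(m−1) (φ(T₁) φ(T₂) − m π(T₁) π(T₂)).
-- For C_k = C(r₁, …, r_k) this yields, by induction on k, the invariant
--   φ(C_{k+1}) φ(C_k) = (x² − r_{k+1}) π(C_{k+1}) π(C_k),
-- and substituting it into the formula for C_{k+2} = C_k ∼ (r_{k+2} − r_{k+1}) C_{k+1} gives the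
-- theorem, in the division-free form obtained by multiplying by x² − r_{n−1}.
module Submission where

open import Defs
open import Data.Nat using (ℕ; zero; suc; _+_; _*_; _∸_; _≤_; _<_; z≤n; s≤s; _<?_; _≡ᵇ_)
import Data.Nat.Properties as ℕ
open import Data.Integer using (+_; -_) renaming (_+_ to _+ℤ_; _*_ to _*ℤ_)
import Data.Integer.Properties as ℤ
open import Data.Bool using (Bool; true; false; T; _∧_; _∨_; if_then_else_)
import Data.Bool.Properties as Bool
open import Data.Fin using (Fin; zero; suc; toℕ; punchIn)
open import Data.List using (List; []; _∷_; _++_; map; replicate)
import Data.List.Properties as List
open import Data.List.Relation.Unary.All as All using (All; []; _∷_)
import Data.List.Relation.Unary.All.Properties as All
open import Data.Maybe as Maybe using (Maybe; just; nothing)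
open import Data.Product as Product using (∃-syntax; _×_; _,_)
open import Data.Sum using (_⊎_; inj₁; inj₂)
open import Data.Empty using (⊥-elim)
open import Function using (_∘_)
open import Relation.Nullary using (yes; no)
open import Relation.Binary.PropositionalEquality as ≡ using (_≡_; _≢_; refl; cong; cong₂)
open import Algebra.Bundles using (CommutativeSemigroup; CommutativeRing)
open import Algebra.Structures using (IsCommutativeMonoid)
import Algebra.Properties.CommutativeSemigroup as CommSemigroupProperties
import Tactic.RingSolver.Core.AlmostCommutativeRing as ACR
open import Tactic.RingSolver using (solve-∀)

-- Adjacency in trees numbered in preorder

≡ᵇ-refl : ∀ a → (a ≡ᵇ a) ≡ true
≡ᵇ-refl zero    = refl
≡ᵇ-refl (suc a) = ≡ᵇ-refl a

≡ᵇ-sym : ∀ a b → (a ≡ᵇ b) ≡ (b ≡ᵇ a)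
≡ᵇ-sym zero    zero    = refl
≡ᵇ-sym zero    (suc b) = refl
≡ᵇ-sym (suc a) zero    = refl
≡ᵇ-sym (suc a) (suc b) = ≡ᵇ-sym a b

≢⇒≡ᵇ-false : ∀ {a b} → a ≢ b → (a ≡ᵇ b) ≡ false
≢⇒≡ᵇ-false {a} {b} a≢b with a ≡ᵇ b in eq
... | true  = ⊥-elim (a≢b (ℕ.≡ᵇ⇒≡ a b (≡.subst T (≡.sym eq) _)))
... | false = refl

≡ᵇ-injective : (g : ℕ → ℕ) → (∀ {x y} → g x ≡ g y → x ≡ y) → ∀ a b → (g a ≡ᵇ g b) ≡ (a ≡ᵇ b)
≡ᵇ-injective g g-inj a b with a ≡ᵇ b in eq
... | true with refl ← ℕ.≡ᵇ⇒≡ a b (≡.subst T (≡.sym eq) _) = ≡ᵇ-refl (g a)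
... | false = ≢⇒≡ᵇ-false λ ga≡gb → ≡.subst T eq (ℕ.≡⇒≡ᵇ a b (g-inj ga≡gb))

joinsᵇ : ℕ → ℕ → ℕ × ℕ → Bool
joinsᵇ a b (u , v) = ((u ≡ᵇ a) ∧ (v ≡ᵇ b)) ∨ ((u ≡ᵇ b) ∧ (v ≡ᵇ a))

adjacentᵇ-++ : ∀ es fs a b → adjacentᵇ (es ++ fs) a b ≡ adjacentᵇ es a b ∨ adjacentᵇ fs a b
adjacentᵇ-++ []       fs a b = refl
adjacentᵇ-++ (e ∷ es) fs a b = begin
  joinsᵇ a b e ∨ adjacentᵇ (es ++ fs) a b                 ≡⟨ cong (joinsᵇ a b e ∨_) (adjacentᵇ-++ es fs a b) ⟩
  joinsᵇ a b e ∨ (adjacentᵇ es a b ∨ adjacentᵇ fs a b)    ≡⟨ ≡.sym (Bool.∨-assoc (joinsᵇ a b e) _ _) ⟩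
  (joinsᵇ a b e ∨ adjacentᵇ es a b) ∨ adjacentᵇ fs a b    ∎
  where open ≡.≡-Reasoning

adjacentᵇ-sym : ∀ es a b → adjacentᵇ es a b ≡ adjacentᵇ es b a
adjacentᵇ-sym []             a b = refl
adjacentᵇ-sym ((u , v) ∷ es) a b =
  cong₂ _∨_ (Bool.∨-comm ((u ≡ᵇ a) ∧ (v ≡ᵇ b)) _) (adjacentᵇ-sym es a b)

relabel : (ℕ → ℕ) → List (ℕ × ℕ) → List (ℕ × ℕ)
relabel g = map (Product.map g g)

adjacentᵇ-relabel : (g : ℕ → ℕ) → (∀ {x y} → g x ≡ g y → x ≡ y) → ∀ es a b →
  adjacentᵇ (relabel g es) (g a) (g b) ≡ adjacentᵇ es a b
adjacentᵇ-relabel g g-inj []             a b = refl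
adjacentᵇ-relabel g g-inj ((u , v) ∷ es) a b = cong₂ _∨_
  (cong₂ _∨_ (cong₂ _∧_ (≡ᵇ-g u a) (≡ᵇ-g v b)) (cong₂ _∧_ (≡ᵇ-g u b) (≡ᵇ-g v a)))
  (adjacentᵇ-relabel g g-inj es a b)
  where
  ≡ᵇ-g : ∀ x y → (g x ≡ᵇ g y) ≡ (x ≡ᵇ y)
  ≡ᵇ-g = ≡ᵇ-injective g g-inj

Avoids : ℕ → ℕ × ℕ → Set
Avoids x (u , v) = u ≢ x × v ≢ x

adjacentᵇ-avoidsˡ : ∀ {es a} b → All (Avoids a) es → adjacentᵇ es a b ≡ false
adjacentᵇ-avoidsˡ b [] = refl
adjacentᵇ-avoidsˡ b (_∷_ {x = u , v} (u≢a , v≢a) avoid) rewrite ≢⇒≡ᵇ-false u≢a | ≢⇒≡ᵇ-false v≢a =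
  cong₂ _∨_ (Bool.∧-zeroʳ (u ≡ᵇ b)) (adjacentᵇ-avoidsˡ b avoid)

adjacentᵇ-avoidsʳ : ∀ {es} a {b} → All (Avoids b) es → adjacentᵇ es a b ≡ false
adjacentᵇ-avoidsʳ {es} a {b} avoid = ≡.trans (adjacentᵇ-sym es a b) (adjacentᵇ-avoidsˡ a avoid)

Ordered : ℕ × ℕ → Set
Ordered (u , v) = u < v

adjacentᵇ-irrefl : ∀ es x → All Ordered es → adjacentᵇ es x x ≡ false
adjacentᵇ-irrefl []             x []                = refl
adjacentᵇ-irrefl ((u , v) ∷ es) x (u<v ∷ ordered) with u ℕ.≟ x
... | yes refl rewrite ≢⇒≡ᵇ-false (ℕ.<⇒≢ u<v ∘ ≡.sym) | Bool.∧-zeroʳ (u ≡ᵇ u) =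
  adjacentᵇ-irrefl es x ordered
... | no u≢x   rewrite ≢⇒≡ᵇ-false u≢x = adjacentᵇ-irrefl es x ordered

relabel-root : (g : ℕ → ℕ) → ∀ {o w} → (∀ x → g (o + x) ≡ w + x) → g o ≡ w
relabel-root g {o} {w} shift = ≡.trans (cong g (≡.sym (ℕ.+-identityʳ o))) (≡.trans (shift 0) (ℕ.+-identityʳ w))

mutual
  edges-relabel : (g : ℕ → ℕ) → ∀ t o w → (∀ x → g (o + x) ≡ w + x) → edges t w ≡ relabel g (edges t o)
  edges-relabel g (node ts) o w shift =
    ≡.trans (cong (λ r → forestEdges ts r (suc w)) (≡.sym (relabel-root g shift)))
            (forestEdges-relabel g ts o (suc o) (suc w) λ x →
               ≡.trans (cong g (≡.sym (ℕ.+-suc o x))) (≡.trans (shift (suc x)) (ℕ.+-suc w x)))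

  forestEdges-relabel : (g : ℕ → ℕ) → ∀ ts p o w → (∀ x → g (o + x) ≡ w + x) →
    forestEdges ts (g p) w ≡ relabel g (forestEdges ts p o)
  forestEdges-relabel g []       p o w shift = refl
  forestEdges-relabel g (t ∷ ts) p o w shift = cong₂ _∷_ (cong (g p ,_) (≡.sym (relabel-root g shift))) (begin
    edges t w ++ forestEdges ts (g p) (w + size t)
      ≡⟨ cong₂ _++_ (edges-relabel g t o w shift) (forestEdges-relabel g ts p (o + size t) (w + size t) λ x →
           ≡.trans (cong g (ℕ.+-assoc o (size t) x)) (≡.trans (shift (size t + x)) (≡.sym (ℕ.+-assoc w (size t) x)))) ⟩
    relabel g (edges t o) ++ relabel g (forestEdges ts p (o + size t))
      ≡⟨ ≡.sym (List.map-++ (Product.map g g) (edges t o) _) ⟩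
    relabel g (edges t o ++ forestEdges ts p (o + size t)) ∎)
    where open ≡.≡-Reasoning

mutual
  edges-ordered : ∀ t o → All Ordered (edges t o)
  edges-ordered (node ts) o = forestEdges-ordered ts o (suc o) ℕ.≤-refl

  forestEdges-ordered : ∀ ts p o → p < o → All Ordered (forestEdges ts p o)
  forestEdges-ordered []       p o p<o = []
  forestEdges-ordered (t ∷ ts) p o p<o = p<o ∷ All.++⁺ (edges-ordered t o)
    (forestEdges-ordered ts p (o + size t) (ℕ.≤-trans p<o (ℕ.m≤m+n o (size t))))

Outside : ℕ → ℕ → ℕ → Set
Outside o n x = x < o ⊎ o + n ≤ x

outside⇒≢ : ∀ {o n x} → 0 < n → Outside o n x → o ≢ x
outside⇒≢ 0<n (inj₁ x<o)   refl = ℕ.<-irrefl refl x<o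
outside⇒≢ 0<n (inj₂ o+n≤x) refl = ℕ.<-irrefl refl (ℕ.<-≤-trans (ℕ.m<m+n _ 0<n) o+n≤x)

size-pos : ∀ t → 0 < size t
size-pos (node _) = s≤s z≤n

mutual
  edges-avoids : ∀ t o x → Outside o (size t) x → All (Avoids x) (edges t o)
  edges-avoids (node ts) o x outside =
    forestEdges-avoids ts o (suc o) x (outside⇒≢ (s≤s z≤n) outside) (shifted outside)
    where
    shifted : Outside o (size (node ts)) x → Outside (suc o) (sizes ts) x
    shifted (inj₁ x<o)   = inj₁ (ℕ.m<n⇒m<1+n x<o)
    shifted (inj₂ o+n≤x) = inj₂ (≡.subst (_≤ x) (ℕ.+-suc o (sizes ts)) o+n≤x)

  forestEdges-avoids : ∀ ts p o x → p ≢ x → Outside o (sizes ts) x → All (Avoids x) (forestEdges ts p o)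
  forestEdges-avoids []       p o x p≢x outside = []
  forestEdges-avoids (t ∷ ts) p o x p≢x outside =
    (p≢x , outside⇒≢ (ℕ.<-≤-trans (size-pos t) (ℕ.m≤m+n _ _)) outside)
      ∷ All.++⁺ (edges-avoids t o x (first outside)) (forestEdges-avoids ts p (o + size t) x p≢x (rest outside))
    where
    first : Outside o (sizes (t ∷ ts)) x → Outside o (size t) x
    first (inj₁ x<o)   = inj₁ x<o
    first (inj₂ o+n≤x) = inj₂ (ℕ.≤-trans (ℕ.+-monoʳ-≤ o (ℕ.m≤m+n (size t) (sizes ts))) o+n≤x)
    rest : Outside o (sizes (t ∷ ts)) x → Outside (o + size t) (sizes ts) x
    rest (inj₁ x<o)   = inj₁ (ℕ.≤-trans x<o (ℕ.m≤m+n o (size t)))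
    rest (inj₂ o+n≤x) = inj₂ (≡.subst (_≤ x) (≡.sym (ℕ.+-assoc o (size t) (sizes ts))) o+n≤x)

-- The ring ℤ[x]

coeff-+ₚ : ∀ p q i → coeff (p +ₚ q) i ≡ coeff p i +ℤ coeff q i
coeff-+ₚ []      q       i       = ≡.sym (ℤ.+-identityˡ _)
coeff-+ₚ (a ∷ p) []      i       = ≡.sym (ℤ.+-identityʳ _)
coeff-+ₚ (a ∷ p) (b ∷ q) zero    = refl
coeff-+ₚ (a ∷ p) (b ∷ q) (suc i) = coeff-+ₚ p q i

coeff-negₚ : ∀ p i → coeff (negₚ p) i ≡ - coeff p i
coeff-negₚ []      i       = refl
coeff-negₚ (a ∷ p) zero    = refl
coeff-negₚ (a ∷ p) (suc i) = coeff-negₚ p i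

coeff-scaleₚ : ∀ a p i → coeff (scaleₚ a p) i ≡ a *ℤ coeff p i
coeff-scaleₚ a []      i       = ≡.sym (ℤ.*-zeroʳ a)
coeff-scaleₚ a (b ∷ p) zero    = refl
coeff-scaleₚ a (b ∷ p) (suc i) = coeff-scaleₚ a p i

-- A record rather than _≈ₚ_ itself, so that p and q can be inferred from a proof.
infix 4 _≋_
record _≋_ (p q : Poly) : Set where
  constructor coeffwise
  field coeff-≡ : p ≈ₚ q
open _≋_ public

≋-refl : ∀ {p} → p ≋ p
≋-refl = coeffwise λ _ → refl

≋-sym : ∀ {p q} → p ≋ q → q ≋ p
≋-sym (coeffwise e) = coeffwise λ i → ≡.sym (e i)

≋-trans : ∀ {p q r} → p ≋ q → q ≋ r → p ≋ r
≋-trans (coeffwise e) (coeffwise f) = coeffwise λ i → ≡.trans (e i) (f i)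

≡⇒≋ : ∀ {p q} → p ≡ q → p ≋ q
≡⇒≋ refl = ≋-refl

∷-cong : ∀ {a b p q} → a ≡ b → p ≋ q → a ∷ p ≋ b ∷ q
∷-cong refl (coeffwise e) = coeffwise λ { zero → refl ; (suc i) → e i }

+ₚ-cong : ∀ {p p′ q q′} → p ≋ p′ → q ≋ q′ → p +ₚ q ≋ p′ +ₚ q′
+ₚ-cong {p} {p′} {q} {q′} (coeffwise e) (coeffwise f) = coeffwise go
  where
  go : ∀ i → coeff (p +ₚ q) i ≡ coeff (p′ +ₚ q′) i
  go i rewrite coeff-+ₚ p q i | coeff-+ₚ p′ q′ i = cong₂ _+ℤ_ (e i) (f i)

+ₚ-congˡ : ∀ p {q q′} → q ≋ q′ → p +ₚ q ≋ p +ₚ q′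
+ₚ-congˡ p = +ₚ-cong (≋-refl {p})

negₚ-cong : ∀ {p p′} → p ≋ p′ → negₚ p ≋ negₚ p′
negₚ-cong {p} {p′} (coeffwise e) = coeffwise go
  where
  go : ∀ i → coeff (negₚ p) i ≡ coeff (negₚ p′) i
  go i rewrite coeff-negₚ p i | coeff-negₚ p′ i = cong -_ (e i)

scaleₚ-cong : ∀ a {p p′} → p ≋ p′ → scaleₚ a p ≋ scaleₚ a p′
scaleₚ-cong a {p} {p′} (coeffwise e) = coeffwise go
  where
  go : ∀ i → coeff (scaleₚ a p) i ≡ coeff (scaleₚ a p′) i
  go i rewrite coeff-scaleₚ a p i | coeff-scaleₚ a p′ i = cong (a *ℤ_) (e i)

+ₚ-assoc : ∀ p q r → (p +ₚ q) +ₚ r ≋ p +ₚ (q +ₚ r)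
+ₚ-assoc p q r = coeffwise go
  where
  go : ∀ i → coeff ((p +ₚ q) +ₚ r) i ≡ coeff (p +ₚ (q +ₚ r)) i
  go i rewrite coeff-+ₚ (p +ₚ q) r i | coeff-+ₚ p q i | coeff-+ₚ p (q +ₚ r) i | coeff-+ₚ q r i =
    ℤ.+-assoc (coeff p i) (coeff q i) (coeff r i)

+ₚ-comm : ∀ p q → p +ₚ q ≋ q +ₚ p
+ₚ-comm p q = coeffwise go
  where
  go : ∀ i → coeff (p +ₚ q) i ≡ coeff (q +ₚ p) i
  go i rewrite coeff-+ₚ p q i | coeff-+ₚ q p i = ℤ.+-comm (coeff p i) (coeff q i)

+ₚ-identityʳ : ∀ p → p +ₚ [] ≋ p
+ₚ-identityʳ p = coeffwise λ i → ≡.trans (coeff-+ₚ p [] i) (ℤ.+-identityʳ (coeff p i))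

+ₚ-inverseˡ : ∀ p → negₚ p +ₚ p ≋ []
+ₚ-inverseˡ p = coeffwise go
  where
  go : ∀ i → coeff (negₚ p +ₚ p) i ≡ + 0
  go i rewrite coeff-+ₚ (negₚ p) p i | coeff-negₚ p i = ℤ.+-inverseˡ (coeff p i)


+ₚ-isCommutativeMonoid : IsCommutativeMonoid _≋_ _+ₚ_ []
+ₚ-isCommutativeMonoid = record
  { isMonoid = record
    { isSemigroup = record
      { isMagma = record
        { isEquivalence = record { refl = ≋-refl ; sym = ≋-sym ; trans = ≋-trans }
        ; ∙-cong = +ₚ-cong }
      ; assoc = +ₚ-assoc }
    ; identity = (λ _ → ≋-refl) , +ₚ-identityʳ }
  ; comm = +ₚ-comm }

+ₚ-commutativeSemigroup : CommutativeSemigroup _ _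
+ₚ-commutativeSemigroup = record
  { isCommutativeSemigroup = IsCommutativeMonoid.isCommutativeSemigroup +ₚ-isCommutativeMonoid }

open CommSemigroupProperties +ₚ-commutativeSemigroup
  using () renaming (interchange to +ₚ-interchange; x∙yz≈y∙xz to +ₚ-leftComm)

0∷-≋[] : ∀ {p} → p ≋ [] → + 0 ∷ p ≋ []
0∷-≋[] (coeffwise e) = coeffwise λ { zero → refl ; (suc i) → e i }

scaleₚ-zero : ∀ p → scaleₚ (+ 0) p ≋ []
scaleₚ-zero p = coeffwise λ i → ≡.trans (coeff-scaleₚ (+ 0) p i) (ℤ.*-zeroˡ (coeff p i))

scaleₚ-identity : ∀ p → scaleₚ (+ 1) p ≋ p
scaleₚ-identity p = coeffwise λ i → ≡.trans (coeff-scaleₚ (+ 1) p i) (ℤ.*-identityˡ (coeff p i))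

scaleₚ-assoc : ∀ a b p → scaleₚ (a *ℤ b) p ≋ scaleₚ a (scaleₚ b p)
scaleₚ-assoc a b p = coeffwise go
  where
  go : ∀ i → coeff (scaleₚ (a *ℤ b) p) i ≡ coeff (scaleₚ a (scaleₚ b p)) i
  go i rewrite coeff-scaleₚ (a *ℤ b) p i | coeff-scaleₚ a (scaleₚ b p) i | coeff-scaleₚ b p i =
    ℤ.*-assoc a b (coeff p i)

scaleₚ-distribʳ : ∀ a b p → scaleₚ (a +ℤ b) p ≋ scaleₚ a p +ₚ scaleₚ b p
scaleₚ-distribʳ a b p = coeffwise go
  where
  go : ∀ i → coeff (scaleₚ (a +ℤ b) p) i ≡ coeff (scaleₚ a p +ₚ scaleₚ b p) i
  go i rewrite coeff-scaleₚ (a +ℤ b) p i | coeff-+ₚ (scaleₚ a p) (scaleₚ b p) i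
             | coeff-scaleₚ a p i | coeff-scaleₚ b p i = ℤ.*-distribʳ-+ (coeff p i) a b

scaleₚ-distribˡ : ∀ a p q → scaleₚ a (p +ₚ q) ≋ scaleₚ a p +ₚ scaleₚ a q
scaleₚ-distribˡ a p q = coeffwise go
  where
  go : ∀ i → coeff (scaleₚ a (p +ₚ q)) i ≡ coeff (scaleₚ a p +ₚ scaleₚ a q) i
  go i rewrite coeff-scaleₚ a (p +ₚ q) i | coeff-+ₚ (scaleₚ a p) (scaleₚ a q) i
             | coeff-scaleₚ a p i | coeff-scaleₚ a q i | coeff-+ₚ p q i = ℤ.*-distribˡ-+ a (coeff p i) (coeff q i)

0∷-scaleₚ : ∀ a p → + 0 ∷ scaleₚ a p ≋ scaleₚ a (+ 0 ∷ p)
0∷-scaleₚ a p = ∷-cong (≡.sym (ℤ.*-zeroʳ a)) ≋-refl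

*ₚ-zeroʳ : ∀ p → p *ₚ [] ≋ []
*ₚ-zeroʳ []      = ≋-refl
*ₚ-zeroʳ (a ∷ p) = 0∷-≋[] (*ₚ-zeroʳ p)

≋[]-*ₚ : ∀ {p} q → p ≋ [] → p *ₚ q ≋ []
≋[]-*ₚ {[]}    q e = ≋-refl
≋[]-*ₚ {a ∷ p} q (coeffwise e) with e zero
... | refl = +ₚ-cong (scaleₚ-zero q) (0∷-≋[] (≋[]-*ₚ {p} q (coeffwise λ i → e (suc i))))

*ₚ-congˡ : ∀ p {q q′} → q ≋ q′ → p *ₚ q ≋ p *ₚ q′
*ₚ-congˡ []      e = ≋-refl
*ₚ-congˡ (a ∷ p) e = +ₚ-cong (scaleₚ-cong a e) (∷-cong refl (*ₚ-congˡ p e))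

*ₚ-≋[] : ∀ p {q} → q ≋ [] → p *ₚ q ≋ []
*ₚ-≋[] p e = ≋-trans (*ₚ-congˡ p e) (*ₚ-zeroʳ p)

*ₚ-congʳ : ∀ {p p′} q → p ≋ p′ → p *ₚ q ≋ p′ *ₚ q
*ₚ-congʳ {[]}    {p′}     q e = ≋-sym (≋[]-*ₚ q (≋-sym e))
*ₚ-congʳ {a ∷ p} {[]}     q e = ≋[]-*ₚ q e
*ₚ-congʳ {a ∷ p} {b ∷ p′} q (coeffwise e) with e zero
... | refl = +ₚ-cong ≋-refl (∷-cong refl (*ₚ-congʳ {p} {p′} q (coeffwise λ i → e (suc i))))

*ₚ-cong : ∀ {p p′ q q′} → p ≋ p′ → q ≋ q′ → p *ₚ q ≋ p′ *ₚ q′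
*ₚ-cong {p′ = p′} {q = q} e f = ≋-trans (*ₚ-congʳ q e) (*ₚ-congˡ p′ f)

*ₚ-distribʳ : ∀ q p p′ → (p +ₚ p′) *ₚ q ≋ p *ₚ q +ₚ p′ *ₚ q
*ₚ-distribʳ q []      p′       = ≋-refl
*ₚ-distribʳ q (a ∷ p) []       = ≋-sym (+ₚ-identityʳ _)
*ₚ-distribʳ q (a ∷ p) (b ∷ p′) = ≋-trans
  (+ₚ-cong (scaleₚ-distribʳ a b q) (∷-cong refl (*ₚ-distribʳ q p p′)))
  (+ₚ-interchange (scaleₚ a q) (scaleₚ b q) (+ 0 ∷ p *ₚ q) (+ 0 ∷ p′ *ₚ q))

scaleₚ-*ₚ : ∀ a p q → scaleₚ a p *ₚ q ≋ scaleₚ a (p *ₚ q)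
scaleₚ-*ₚ a []      q = ≋-refl
scaleₚ-*ₚ a (b ∷ p) q = ≋-trans
  (+ₚ-cong (scaleₚ-assoc a b q) (≋-trans (∷-cong refl (scaleₚ-*ₚ a p q)) (0∷-scaleₚ a (p *ₚ q))))
  (≋-sym (scaleₚ-distribˡ a (scaleₚ b q) (+ 0 ∷ p *ₚ q)))

0∷-*ₚ : ∀ p q → (+ 0 ∷ p) *ₚ q ≋ + 0 ∷ p *ₚ q
0∷-*ₚ p q = +ₚ-cong (scaleₚ-zero q) ≋-refl

*ₚ-assoc : ∀ p q r → (p *ₚ q) *ₚ r ≋ p *ₚ (q *ₚ r)
*ₚ-assoc []      q r = ≋-refl
*ₚ-assoc (a ∷ p) q r = ≋-trans (*ₚ-distribʳ r (scaleₚ a q) (+ 0 ∷ p *ₚ q))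
  (+ₚ-cong (scaleₚ-*ₚ a q r) (≋-trans (0∷-*ₚ (p *ₚ q) r) (∷-cong refl (*ₚ-assoc p q r))))

*ₚ-identityˡ : ∀ p → 1ₚ *ₚ p ≋ p
*ₚ-identityˡ p = ≋-trans (+ₚ-cong (scaleₚ-identity p) (0∷-≋[] ≋-refl)) (+ₚ-identityʳ p)

*ₚ-∷ʳ : ∀ q a p → q *ₚ (a ∷ p) ≋ scaleₚ a q +ₚ (+ 0 ∷ q *ₚ p)
*ₚ-∷ʳ []      a p = ≋-sym (0∷-≋[] ≋-refl)
*ₚ-∷ʳ (b ∷ q) a p = ≋-trans
  (∷-cong (≡.trans (ℤ.+-identityʳ (b *ℤ a)) (ℤ.*-comm b a))
          (≋-trans (+ₚ-cong ≋-refl (*ₚ-∷ʳ q a p)) (+ₚ-leftComm (scaleₚ b p) (scaleₚ a q) (+ 0 ∷ q *ₚ p))))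
  (≋-sym (∷-cong (ℤ.+-identityʳ (a *ℤ b)) ≋-refl))

*ₚ-comm : ∀ p q → p *ₚ q ≋ q *ₚ p
*ₚ-comm []      q = ≋-sym (*ₚ-zeroʳ q)
*ₚ-comm (a ∷ p) q = ≋-trans (+ₚ-cong ≋-refl (∷-cong refl (*ₚ-comm p q))) (≋-sym (*ₚ-∷ʳ q a p))

*ₚ-distribˡ : ∀ q p p′ → q *ₚ (p +ₚ p′) ≋ q *ₚ p +ₚ q *ₚ p′
*ₚ-distribˡ q p p′ = ≋-trans (*ₚ-comm q (p +ₚ p′))
  (≋-trans (*ₚ-distribʳ q p p′) (+ₚ-cong (*ₚ-comm p q) (*ₚ-comm p′ q)))

ℤ[X] : CommutativeRing _ _
ℤ[X] = record
  { isCommutativeRing = record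
    { isRing = record
      { +-isAbelianGroup = record
        { isGroup = record
          { isMonoid = IsCommutativeMonoid.isMonoid +ₚ-isCommutativeMonoid
          ; inverse = +ₚ-inverseˡ , (λ p → ≋-trans (+ₚ-comm p (negₚ p)) (+ₚ-inverseˡ p))
          ; ⁻¹-cong = negₚ-cong }
        ; comm = +ₚ-comm }
      ; *-cong = *ₚ-cong
      ; *-assoc = *ₚ-assoc
      ; *-identity = *ₚ-identityˡ , (λ p → ≋-trans (*ₚ-comm p 1ₚ) (*ₚ-identityˡ p))
      ; distrib = *ₚ-distribˡ , *ₚ-distribʳ }
    ; *-comm = *ₚ-comm } }

open import Algebra.Properties.Ring (CommutativeRing.ring ℤ[X])
  using () renaming (-‿distribˡ-* to negₚ-distribˡ-*ₚ)

-- The solver only identifies normal forms once it can recognise vanishing coefficients.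
ℤ[X]-ring : ACR.AlmostCommutativeRing _ _
ℤ[X]-ring = ACR.fromCommutativeRing ℤ[X] []≋?
  where
  []≋? : ∀ p → Maybe ([] ≋ p)
  []≋? []            = just ≋-refl
  []≋? (+ zero ∷ p)  = Maybe.map (λ e → ≋-sym (0∷-≋[] (≋-sym e))) ([]≋? p)
  []≋? (_ ∷ p)       = nothing

open import Relation.Binary.Reasoning.Setoid (CommutativeRing.setoid ℤ[X])

-- Determinants by Laplace expansion along the first row

signₚ-suc : ∀ k → signₚ (suc k) ≋ negₚ (signₚ k)
signₚ-suc zero          = ≋-refl
signₚ-suc (suc zero)    = ≋-refl
signₚ-suc (suc (suc k)) = signₚ-suc k

signₚ-+ : ∀ a b → signₚ (a + b) ≋ signₚ a *ₚ signₚ b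
signₚ-+ zero    b = ≋-sym (*ₚ-identityˡ (signₚ b))
signₚ-+ (suc a) b = begin
  signₚ (suc (a + b))          ≈⟨ signₚ-suc (a + b) ⟩
  negₚ (signₚ (a + b))         ≈⟨ negₚ-cong (signₚ-+ a b) ⟩
  negₚ (signₚ a *ₚ signₚ b)    ≈⟨ negₚ-distribˡ-*ₚ (signₚ a) (signₚ b) ⟩
  negₚ (signₚ a) *ₚ signₚ b    ≈⟨ *ₚ-congʳ (signₚ b) (≋-sym (signₚ-suc a)) ⟩
  signₚ (suc a) *ₚ signₚ b     ∎

signₚ-square : ∀ a → signₚ a *ₚ signₚ a ≋ 1ₚ
signₚ-square zero          = *ₚ-identityˡ 1ₚ
signₚ-square (suc zero)    = ≋-refl
signₚ-square (suc (suc a)) = signₚ-square a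

sumℕ : ℕ → (ℕ → Poly) → Poly
sumℕ zero    f = []
sumℕ (suc n) f = f 0 +ₚ sumℕ n (λ j → f (suc j))

sumℕ-cong : ∀ n {f g : ℕ → Poly} → (∀ j → j < n → f j ≋ g j) → sumℕ n f ≋ sumℕ n g
sumℕ-cong zero    e = ≋-refl
sumℕ-cong (suc n) e = +ₚ-cong (e 0 (s≤s z≤n)) (sumℕ-cong n (λ j j<n → e (suc j) (s≤s j<n)))

sumℕ-≋[] : ∀ n {f : ℕ → Poly} → (∀ j → j < n → f j ≋ []) → sumℕ n f ≋ []
sumℕ-≋[] zero    e = ≋-refl
sumℕ-≋[] (suc n) e = +ₚ-cong (e 0 (s≤s z≤n)) (sumℕ-≋[] n (λ j j<n → e (suc j) (s≤s j<n)))

sumℕ-+ : ∀ a b (f : ℕ → Poly) → sumℕ (a + b) f ≋ sumℕ a f +ₚ sumℕ b (λ j → f (a + j))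
sumℕ-+ zero    b f = ≋-refl
sumℕ-+ (suc a) b f = ≋-trans (+ₚ-congˡ (f 0) (sumℕ-+ a b (λ j → f (suc j))))
                              (≋-sym (+ₚ-assoc (f 0) _ _))

sumℕ-+ₚ : ∀ n (f g : ℕ → Poly) → sumℕ n (λ j → f j +ₚ g j) ≋ sumℕ n f +ₚ sumℕ n g
sumℕ-+ₚ zero    f g = ≋-refl
sumℕ-+ₚ (suc n) f g = ≋-trans (+ₚ-cong ≋-refl (sumℕ-+ₚ n (λ j → f (suc j)) (λ j → g (suc j))))
                               (+ₚ-interchange (f 0) (g 0) _ _)

sumℕ-*ₚʳ : ∀ n (f : ℕ → Poly) c → sumℕ n f *ₚ c ≋ sumℕ n (λ j → f j *ₚ c)
sumℕ-*ₚʳ zero    f c = ≋-refl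
sumℕ-*ₚʳ (suc n) f c = ≋-trans (*ₚ-distribʳ c (f 0) _) (+ₚ-cong ≋-refl (sumℕ-*ₚʳ n (λ j → f (suc j)) c))

sumℕ-*ₚˡ : ∀ n (f : ℕ → Poly) c → c *ₚ sumℕ n f ≋ sumℕ n (λ j → c *ₚ f j)
sumℕ-*ₚˡ zero    f c = *ₚ-zeroʳ c
sumℕ-*ₚˡ (suc n) f c = ≋-trans (*ₚ-distribˡ c (f 0) _) (+ₚ-cong ≋-refl (sumℕ-*ₚˡ n (λ j → f (suc j)) c))

punchInℕ : ℕ → ℕ → ℕ
punchInℕ zero    k       = suc k
punchInℕ (suc j) zero    = zero
punchInℕ (suc j) (suc k) = suc (punchInℕ j k)

punchInℕ-< : ∀ {j k} → k < j → punchInℕ j k ≡ k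
punchInℕ-< {suc j} {zero}  _         = refl
punchInℕ-< {suc j} {suc k} (s≤s k<j) = cong suc (punchInℕ-< k<j)

punchInℕ-≥ : ∀ {j k} → j ≤ k → punchInℕ j k ≡ suc k
punchInℕ-≥ {zero}  {k}     _         = refl
punchInℕ-≥ {suc j} {suc k} (s≤s j≤k) = cong suc (punchInℕ-≥ j≤k)

punchInℕ-≤ : ∀ j k → punchInℕ j k ≤ suc k
punchInℕ-≤ zero    k       = ℕ.≤-refl
punchInℕ-≤ (suc j) zero    = z≤n
punchInℕ-≤ (suc j) (suc k) = s≤s (punchInℕ-≤ j k)

≤-punchInℕ : ∀ j k → k ≤ punchInℕ j k
≤-punchInℕ zero    k       = ℕ.n≤1+n k
≤-punchInℕ (suc j) zero    = z≤n
≤-punchInℕ (suc j) (suc k) = s≤s (≤-punchInℕ j k)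

punchInℕ-+ : ∀ a b k → punchInℕ (a + b) (a + k) ≡ a + punchInℕ b k
punchInℕ-+ zero    b k = refl
punchInℕ-+ (suc a) b k = cong suc (punchInℕ-+ a b k)

toℕ-punchIn : ∀ {n} (j : Fin (suc n)) (k : Fin n) → toℕ (punchIn j k) ≡ punchInℕ (toℕ j) (toℕ k)
toℕ-punchIn zero    k       = refl
toℕ-punchIn (suc j) zero    = refl
toℕ-punchIn (suc j) (suc k) = cong suc (toℕ-punchIn j k)

Matrix : Set
Matrix = ℕ → ℕ → Poly

minor : ℕ → Matrix → Matrix
minor j M i k = M (suc i) (punchInℕ j k)

mutual
  detℕ : ℕ → Matrix → Poly
  detℕ zero    M = 1ₚ
  detℕ (suc n) M = sumℕ (suc n) (laplaceTerm n M)

  laplaceTerm : ℕ → Matrix → ℕ → Poly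
  laplaceTerm n M j = signₚ j *ₚ M 0 j *ₚ detℕ n (minor j M)

sumₚ-cong : ∀ n {f g : Fin n → Poly} → (∀ j → f j ≡ g j) → sumₚ n f ≡ sumₚ n g
sumₚ-cong zero    e = refl
sumₚ-cong (suc n) e = cong₂ _+ₚ_ (e zero) (sumₚ-cong n (λ j → e (suc j)))

sumₚ-toℕ : ∀ n (f : ℕ → Poly) → sumₚ n (λ j → f (toℕ j)) ≡ sumℕ n f
sumₚ-toℕ zero    f = refl
sumₚ-toℕ (suc n) f = cong (f 0 +ₚ_) (sumₚ-toℕ n (λ j → f (suc j)))

det-cong : ∀ n {M M′ : Fin n → Fin n → Poly} → (∀ i j → M i j ≡ M′ i j) → det n M ≡ det n M′
det-cong zero    e = refl
det-cong (suc n) e = sumₚ-cong (suc n) λ j →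
  cong₂ _*ₚ_ (cong (signₚ (toℕ j) *ₚ_) (e zero j)) (det-cong n (λ i k → e (suc i) (punchIn j k)))

det≡detℕ : ∀ n (M : Matrix) → det n (λ i j → M (toℕ i) (toℕ j)) ≡ detℕ n M
det≡detℕ zero    M = refl
det≡detℕ (suc n) M = ≡.trans
  (sumₚ-cong (suc n) λ j → cong (signₚ (toℕ j) *ₚ M 0 (toℕ j) *ₚ_) (≡.trans
    (det-cong n (λ i k → cong (M (suc (toℕ i))) (toℕ-punchIn j k)))
    (det≡detℕ n (minor (toℕ j) M))))
  (sumₚ-toℕ (suc n) (laplaceTerm n M))

detℕ-cong : ∀ n {M M′ : Matrix} → (∀ i j → i < n → j < n → M i j ≋ M′ i j) → detℕ n M ≋ detℕ n M′
detℕ-cong zero    e = ≋-refl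
detℕ-cong (suc n) e = sumℕ-cong (suc n) λ j j<1+n →
  *ₚ-cong (*ₚ-congˡ (signₚ j) (e 0 j (s≤s z≤n) j<1+n))
          (detℕ-cong n λ i k i<n k<n → e (suc i) _ (s≤s i<n) (ℕ.≤-<-trans (punchInℕ-≤ j k) (s≤s k<n)))

laplaceTerm-≋[] : ∀ n M j → M 0 j ≋ [] → laplaceTerm n M j ≋ []
laplaceTerm-≋[] n M j e = ≋[]-*ₚ (detℕ n (minor j M)) (*ₚ-≋[] (signₚ j) e)

detℕ-column₀-≋[] : ∀ n (M : Matrix) → (∀ i → i < suc n → M i 0 ≋ []) → detℕ (suc n) M ≋ []
detℕ-column₀-≋[] zero    M z = +ₚ-cong (laplaceTerm-≋[] 0 M 0 (z 0 (s≤s z≤n))) ≋-refl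
detℕ-column₀-≋[] (suc n) M z = sumℕ-≋[] (suc (suc n)) term
  where
  term : ∀ j → j < suc (suc n) → laplaceTerm (suc n) M j ≋ []
  term zero    _ = laplaceTerm-≋[] (suc n) M 0 (z 0 (s≤s z≤n))
  term (suc j) _ = *ₚ-≋[] (signₚ (suc j) *ₚ M 0 (suc j))
    (detℕ-column₀-≋[] n (minor (suc j) M) λ i i<1+n → z (suc i) (s≤s i<1+n))

detℕ-column₀-top : ∀ n (M : Matrix) → (∀ i → i < n → M (suc i) 0 ≋ []) →
  detℕ (suc n) M ≋ M 0 0 *ₚ detℕ n (minor 0 M)
detℕ-column₀-top n M z =
  ≋-trans (+ₚ-cong (*ₚ-congʳ _ (*ₚ-identityˡ (M 0 0))) (sumℕ-≋[] n (rest n M z))) (+ₚ-identityʳ _)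
  where
  rest : ∀ n M → (∀ i → i < n → M (suc i) 0 ≋ []) → ∀ j → j < n → laplaceTerm n M (suc j) ≋ []
  rest (suc n) M z j _ = *ₚ-≋[] (signₚ (suc j) *ₚ M 0 (suc j)) (detℕ-column₀-≋[] n (minor (suc j) M) z)

laplaceTerm₀-column₀-+ : ∀ n (M M₁ M₂ : Matrix) → M 0 0 ≋ M₁ 0 0 +ₚ M₂ 0 0 →
  (∀ i j → M₁ i (suc j) ≋ M i (suc j)) → (∀ i j → M₂ i (suc j) ≋ M i (suc j)) →
  laplaceTerm n M 0 ≋ laplaceTerm n M₁ 0 +ₚ laplaceTerm n M₂ 0
laplaceTerm₀-column₀-+ n M M₁ M₂ split e₁ e₂ = begin
  1ₚ *ₚ M 0 0 *ₚ D
    ≈⟨ *ₚ-congʳ D (*ₚ-congˡ 1ₚ split) ⟩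
  1ₚ *ₚ (M₁ 0 0 +ₚ M₂ 0 0) *ₚ D
    ≈⟨ distrib 1ₚ (M₁ 0 0) (M₂ 0 0) D ⟩
  1ₚ *ₚ M₁ 0 0 *ₚ D +ₚ 1ₚ *ₚ M₂ 0 0 *ₚ D
    ≈⟨ +ₚ-cong (*ₚ-congˡ (1ₚ *ₚ M₁ 0 0) (minor₀-same {M₁} e₁))
               (*ₚ-congˡ (1ₚ *ₚ M₂ 0 0) (minor₀-same {M₂} e₂)) ⟩
  laplaceTerm n M₁ 0 +ₚ laplaceTerm n M₂ 0 ∎
  where
  D = detℕ n (minor 0 M)
  distrib : ∀ s a b d → s *ₚ (a +ₚ b) *ₚ d ≋ s *ₚ a *ₚ d +ₚ s *ₚ b *ₚ d
  distrib = solve-∀ ℤ[X]-ring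
  minor₀-same : ∀ {M′} → (∀ i j → M′ i (suc j) ≋ M i (suc j)) → D ≋ detℕ n (minor 0 M′)
  minor₀-same e = detℕ-cong n λ i k _ _ → ≋-sym (e (suc i) k)

detℕ-column₀-+ : ∀ n (M M₁ M₂ : Matrix) → (∀ i → M i 0 ≋ M₁ i 0 +ₚ M₂ i 0) →
  (∀ i j → M₁ i (suc j) ≋ M i (suc j)) → (∀ i j → M₂ i (suc j) ≋ M i (suc j)) →
  detℕ (suc n) M ≋ detℕ (suc n) M₁ +ₚ detℕ (suc n) M₂
detℕ-column₀-+ zero M M₁ M₂ split e₁ e₂ =
  ≋-trans (sumℕ-cong 1 term) (sumℕ-+ₚ 1 (laplaceTerm 0 M₁) (laplaceTerm 0 M₂))
  where
  term : ∀ j → j < 1 → laplaceTerm 0 M j ≋ laplaceTerm 0 M₁ j +ₚ laplaceTerm 0 M₂ j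
  term zero    _         = laplaceTerm₀-column₀-+ 0 M M₁ M₂ (split 0) e₁ e₂
  term (suc j) (s≤s ())
detℕ-column₀-+ (suc n) M M₁ M₂ split e₁ e₂ =
  ≋-trans (sumℕ-cong (suc (suc n)) term) (sumℕ-+ₚ (suc (suc n)) (laplaceTerm (suc n) M₁) (laplaceTerm (suc n) M₂))
  where
  term : ∀ j → j < suc (suc n) → laplaceTerm (suc n) M j ≋ laplaceTerm (suc n) M₁ j +ₚ laplaceTerm (suc n) M₂ j
  term zero    _ = laplaceTerm₀-column₀-+ (suc n) M M₁ M₂ (split 0) e₁ e₂
  term (suc j) _ = begin
    s *ₚ M 0 (suc j) *ₚ detℕ (suc n) (minor (suc j) M)
      ≈⟨ *ₚ-congˡ (s *ₚ M 0 (suc j)) (detℕ-column₀-+ n (minor (suc j) M) (minor (suc j) M₁) (minor (suc j) M₂)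
           (λ i → split (suc i)) (λ i k → e₁ (suc i) (punchInℕ j k)) (λ i k → e₂ (suc i) (punchInℕ j k))) ⟩
    s *ₚ M 0 (suc j) *ₚ (d₁ +ₚ d₂)
      ≈⟨ *ₚ-distribˡ (s *ₚ M 0 (suc j)) d₁ d₂ ⟩
    s *ₚ M 0 (suc j) *ₚ d₁ +ₚ s *ₚ M 0 (suc j) *ₚ d₂
      ≈⟨ +ₚ-cong (*ₚ-congʳ d₁ (*ₚ-congˡ s (≋-sym (e₁ 0 j))))
                 (*ₚ-congʳ d₂ (*ₚ-congˡ s (≋-sym (e₂ 0 j)))) ⟩
    laplaceTerm (suc n) M₁ (suc j) +ₚ laplaceTerm (suc n) M₂ (suc j) ∎
    where
    s = signₚ (suc j)
    d₁ = detℕ (suc n) (minor (suc j) M₁)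
    d₂ = detℕ (suc n) (minor (suc j) M₂)

-- The last q + 1 rows live in the last q columns, so they are dependent.
detℕ-lowerLeftZero : ∀ p q (M : Matrix) → (∀ i j → p ≤ i → j ≤ p → M i j ≋ []) → detℕ (p + suc q) M ≋ []
detℕ-lowerLeftZero zero    q M z = detℕ-column₀-≋[] q M λ i _ → z i 0 z≤n z≤n
detℕ-lowerLeftZero (suc p) q M z = sumℕ-≋[] (suc (p + suc q)) λ j _ →
  *ₚ-≋[] (signₚ j *ₚ M 0 j) (detℕ-lowerLeftZero p q (minor j M) λ i k p≤i k≤p →
    z (suc i) (punchInℕ j k) (s≤s p≤i) (ℕ.≤-trans (punchInℕ-≤ j k) (s≤s k≤p)))

-- skipBlock a p j is the j-th column of M outside the block of columns a, …, a + p - 1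
skipBlock : ℕ → ℕ → ℕ → ℕ
skipBlock zero    p j       = p + j
skipBlock (suc a) p zero    = zero
skipBlock (suc a) p (suc j) = suc (skipBlock a p j)

skipBlock-0 : ∀ a j → skipBlock a 0 j ≡ j
skipBlock-0 zero    j       = refl
skipBlock-0 (suc a) zero    = refl
skipBlock-0 (suc a) (suc j) = cong suc (skipBlock-0 a j)

punchInℕ-skipBlock : ∀ a b p j → b ≤ p → punchInℕ (a + b) (skipBlock a p j) ≡ skipBlock a (suc p) j
punchInℕ-skipBlock zero    b p j       b≤p = punchInℕ-≥ (ℕ.≤-trans b≤p (ℕ.m≤m+n p j))
punchInℕ-skipBlock (suc a) b p zero    b≤p = refl
punchInℕ-skipBlock (suc a) b p (suc j) b≤p = cong suc (punchInℕ-skipBlock a b p j b≤p)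

TopRowsInBlock : ℕ → ℕ → Matrix → Set
TopRowsInBlock p a M = ∀ i j → i < p → (j < a ⊎ a + p ≤ j) → M i j ≋ []

minor-topRowsInBlock : ∀ p a b M → b ≤ p → TopRowsInBlock (suc p) a M → TopRowsInBlock p a (minor (a + b) M)
minor-topRowsInBlock p a b M b≤p z i j i<p (inj₁ j<a) =
  ≋-trans (≡⇒≋ (cong (M (suc i)) (punchInℕ-< (ℕ.≤-trans j<a (ℕ.m≤m+n a b))))) (z (suc i) j (s≤s i<p) (inj₁ j<a))
minor-topRowsInBlock p a b M b≤p z i j i<p (inj₂ a+p≤j) =
  ≋-trans (≡⇒≋ (cong (M (suc i)) (punchInℕ-≥ (ℕ.≤-trans (ℕ.+-monoʳ-≤ a b≤p) a+p≤j))))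
          (z (suc i) (suc j) (s≤s i<p) (inj₂ (≡.subst (_≤ suc j) (≡.sym (ℕ.+-suc a p)) (s≤s a+p≤j))))

-- Moving the block columns in front of the a columns preceding them gives the sign (-1)^(a p).
mutual
  detℕ-topRowsInBlock : ∀ p a r (M : Matrix) → TopRowsInBlock p a M →
    detℕ (p + (a + r)) M ≋
      signₚ (a * p) *ₚ detℕ p (λ i j → M i (a + j)) *ₚ detℕ (a + r) (λ i j → M (p + i) (skipBlock a p j))
  detℕ-topRowsInBlock zero a r M z = begin
    R                               ≈⟨ detℕ-cong (a + r) (λ i j _ _ → ≡⇒≋ (cong (M i) (≡.sym (skipBlock-0 a j)))) ⟩
    R′                              ≈⟨ ≋-sym (*ₚ-identityˡ R′) ⟩
    1ₚ *ₚ R′                        ≈⟨ *ₚ-congʳ R′ (≋-sym (*ₚ-identityˡ 1ₚ)) ⟩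
    1ₚ *ₚ 1ₚ *ₚ R′                  ≡⟨ cong (λ k → signₚ k *ₚ 1ₚ *ₚ R′) (≡.sym (ℕ.*-zeroʳ a)) ⟩
    signₚ (a * 0) *ₚ 1ₚ *ₚ R′       ∎
    where
    R = detℕ (a + r) M
    R′ = detℕ (a + r) (λ i j → M i (skipBlock a 0 j))
  detℕ-topRowsInBlock (suc p) a r M z = begin
    sumℕ (suc p + (a + r)) L
      ≡⟨ cong (λ n → sumℕ n L) (x∙yz≈y∙xz (suc p) a r) ⟩
    sumℕ (a + (suc p + r)) L
      ≈⟨ sumℕ-+ a (suc p + r) L ⟩
    sumℕ a L +ₚ sumℕ (suc p + r) (λ b → L (a + b))
      ≈⟨ +ₚ-cong (sumℕ-≋[] a before) (sumℕ-+ (suc p) r (λ b → L (a + b))) ⟩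
    sumℕ (suc p) (λ b → L (a + b)) +ₚ sumℕ r (λ c → L (a + (suc p + c)))
      ≈⟨ +ₚ-cong (sumℕ-cong (suc p) inside) (sumℕ-≋[] r after) ⟩
    sumℕ (suc p) (λ b → S *ₚ laplaceTerm p A b *ₚ R) +ₚ []
      ≈⟨ +ₚ-identityʳ _ ⟩
    sumℕ (suc p) (λ b → S *ₚ laplaceTerm p A b *ₚ R)
      ≈⟨ ≋-sym (sumℕ-*ₚʳ (suc p) (λ b → S *ₚ laplaceTerm p A b) R) ⟩
    sumℕ (suc p) (λ b → S *ₚ laplaceTerm p A b) *ₚ R
      ≈⟨ *ₚ-congʳ R (≋-sym (sumℕ-*ₚˡ (suc p) (laplaceTerm p A) S)) ⟩
    S *ₚ detℕ (suc p) A *ₚ R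
      ≈⟨ *ₚ-congʳ R (*ₚ-congʳ (detℕ (suc p) A) S≋sign) ⟩
    signₚ (a * suc p) *ₚ detℕ (suc p) A *ₚ R ∎
    where
    open CommSemigroupProperties ℕ.+-commutativeSemigroup using (x∙yz≈y∙xz)
    L = laplaceTerm (p + (a + r)) M
    A : Matrix
    A i j = M i (a + j)
    R = detℕ (a + r) (λ i j → M (suc p + i) (skipBlock a (suc p) j))
    S = signₚ a *ₚ signₚ (a * p)
    S≋sign : S ≋ signₚ (a * suc p)
    S≋sign = ≋-trans (≋-sym (signₚ-+ a (a * p))) (≡⇒≋ (cong signₚ (≡.sym (ℕ.*-suc a p))))
    before : ∀ j → j < a → L j ≋ []
    before j j<a = laplaceTerm-≋[] (p + (a + r)) M j (z 0 j (s≤s z≤n) (inj₁ j<a))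
    after : ∀ c → c < r → L (a + (suc p + c)) ≋ []
    after c _ = laplaceTerm-≋[] (p + (a + r)) M _ (z 0 _ (s≤s z≤n) (inj₂ (ℕ.+-monoʳ-≤ a (ℕ.m≤m+n (suc p) c))))
    inside : ∀ b → b < suc p → L (a + b) ≋ S *ₚ laplaceTerm p A b *ₚ R
    inside b b<1+p = laplaceTerm-topRowsInBlock p a r M z b (ℕ.≤-pred b<1+p)

  laplaceTerm-topRowsInBlock : ∀ p a r (M : Matrix) → TopRowsInBlock (suc p) a M → ∀ b → b ≤ p →
    laplaceTerm (p + (a + r)) M (a + b) ≋
      signₚ a *ₚ signₚ (a * p) *ₚ laplaceTerm p (λ i j → M i (a + j)) b
        *ₚ detℕ (a + r) (λ i j → M (suc p + i) (skipBlock a (suc p) j))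
  laplaceTerm-topRowsInBlock p a r M z b b≤p = begin
    signₚ (a + b) *ₚ M 0 (a + b) *ₚ detℕ (p + (a + r)) (minor (a + b) M)
      ≈⟨ *ₚ-congˡ (signₚ (a + b) *ₚ M 0 (a + b))
           (detℕ-topRowsInBlock p a r (minor (a + b) M) (minor-topRowsInBlock p a b M b≤p z)) ⟩
    signₚ (a + b) *ₚ M 0 (a + b) *ₚ (signₚ (a * p) *ₚ B′ *ₚ R′)
      ≈⟨ *ₚ-cong (*ₚ-congʳ (M 0 (a + b)) (signₚ-+ a b)) (*ₚ-cong (*ₚ-congˡ (signₚ (a * p)) B′≋B) R′≋R) ⟩
    signₚ a *ₚ signₚ b *ₚ M 0 (a + b) *ₚ (signₚ (a * p) *ₚ B *ₚ R)
      ≈⟨ regroup (signₚ a) (signₚ b) (M 0 (a + b)) (signₚ (a * p)) B R ⟩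
    signₚ a *ₚ signₚ (a * p) *ₚ (signₚ b *ₚ M 0 (a + b) *ₚ B) *ₚ R ∎
    where
    B′ = detℕ p (λ i j → M (suc i) (punchInℕ (a + b) (a + j)))
    B = detℕ p (minor b (λ i j → M i (a + j)))
    R′ = detℕ (a + r) (λ i j → M (suc (p + i)) (punchInℕ (a + b) (skipBlock a p j)))
    R = detℕ (a + r) (λ i j → M (suc p + i) (skipBlock a (suc p) j))
    B′≋B : B′ ≋ B
    B′≋B = detℕ-cong p λ i j _ _ → ≡⇒≋ (cong (M (suc i)) (punchInℕ-+ a b j))
    R′≋R : R′ ≋ R
    R′≋R = detℕ-cong (a + r) λ i j _ _ → ≡⇒≋ (cong (M (suc (p + i))) (punchInℕ-skipBlock a b p j b≤p))
    regroup : ∀ sa sb m sap d r → sa *ₚ sb *ₚ m *ₚ (sap *ₚ d *ₚ r) ≋ sa *ₚ sap *ₚ (sb *ₚ m *ₚ d) *ₚ r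
    regroup = solve-∀ ℤ[X]-ring

topOfColumn₀ bottomOfColumn₀ : ℕ → Matrix → Matrix
topOfColumn₀ s M i zero with i <? s
... | yes _ = M i 0
... | no  _ = []
topOfColumn₀ s M i (suc j) = M i (suc j)
bottomOfColumn₀ s M i zero with i <? s
... | yes _ = []
... | no  _ = M i 0
bottomOfColumn₀ s M i (suc j) = M i (suc j)

topOfColumn₀-≋[] : ∀ s M i → s ≤ i → topOfColumn₀ s M i 0 ≋ []
topOfColumn₀-≋[] s M i s≤i with i <? s
... | yes i<s = ⊥-elim (ℕ.<-irrefl refl (ℕ.<-≤-trans i<s s≤i))
... | no  _   = ≋-refl

bottomOfColumn₀-≋[] : ∀ s M i → i < s → bottomOfColumn₀ s M i 0 ≋ []
bottomOfColumn₀-≋[] s M i i<s with i <? s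
... | yes _   = ≋-refl
... | no  i≮s = ⊥-elim (i≮s i<s)

bottomOfColumn₀-≥ : ∀ s M i → s ≤ i → bottomOfColumn₀ s M i 0 ≡ M i 0
bottomOfColumn₀-≥ s M i s≤i with i <? s
... | yes i<s = ⊥-elim (ℕ.<-irrefl refl (ℕ.<-≤-trans i<s s≤i))
... | no  _   = refl

detℕ-column₀-split : ∀ n s (M : Matrix) →
  detℕ (suc n) M ≋ detℕ (suc n) (topOfColumn₀ s M) +ₚ detℕ (suc n) (bottomOfColumn₀ s M)
detℕ-column₀-split n s M =
  detℕ-column₀-+ n M (topOfColumn₀ s M) (bottomOfColumn₀ s M) split (λ _ _ → ≋-refl) (λ _ _ → ≋-refl)
  where
  split : ∀ i → M i 0 ≋ topOfColumn₀ s M i 0 +ₚ bottomOfColumn₀ s M i 0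
  split i with i <? s
  ... | yes _ = ≋-sym (+ₚ-identityʳ (M i 0))
  ... | no  _ = ≋-refl

-- The characteristic matrix of a tree

charEntry : Bool → Bool → Poly
charEntry diagonal adjacent = (if diagonal then X else []) +ₚ negₚ (constₚ (if adjacent then + 1 else + 0))

charMatrix : List (ℕ × ℕ) → Matrix
charMatrix es i j = charEntry (i ≡ᵇ j) (adjacentᵇ es i j)

φ≡detℕ : ∀ t → φ t ≡ detℕ (size t) (charMatrix (edges t 0))
φ≡detℕ t = det≡detℕ (size t) (charMatrix (edges t 0))

charMatrix-sym : ∀ es i j → charMatrix es i j ≡ charMatrix es j i
charMatrix-sym es i j = cong₂ charEntry (≡ᵇ-sym i j) (adjacentᵇ-sym es i j)

charEntry-off : charEntry false false ≋ []
charEntry-off = coeffwise λ { zero → refl ; (suc i) → refl }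

charEntry-diagonal : charEntry true false ≋ X
charEntry-diagonal = coeffwise λ { zero → refl ; (suc zero) → refl ; (suc (suc i)) → refl }

charMatrix-root : ∀ ts → charMatrix (edges (node ts) 0) 0 0 ≋ X
charMatrix-root ts = ≋-trans (≡⇒≋ (cong (charEntry true) (adjacentᵇ-irrefl _ 0 (edges-ordered (node ts) 0))))
                             charEntry-diagonal

-- In node (t ∷ ts) the root is vertex 0, t occupies the vertices 1 … s and the subtrees in ts follow;
-- restIndex sends the vertices of node ts to their positions there.
module ConsTree (cs ts : List RTree) where

  t : RTree
  t = node cs

  s q : ℕ
  s = size t
  q = sizes ts

  M Mₜ Mₛ : Matrix
  M  = charMatrix (edges (node (t ∷ ts)) 0)
  Mₜ = charMatrix (edges t 0)
  Mₛ = charMatrix (edges (node ts) 0)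

  restIndex : ℕ → ℕ
  restIndex zero    = zero
  restIndex (suc v) = suc (s + v)

  restIndex-injective : ∀ {x y} → restIndex x ≡ restIndex y → x ≡ y
  restIndex-injective {zero}  {zero}  _  = refl
  restIndex-injective {suc x} {suc y} eq = cong suc (ℕ.+-cancelˡ-≡ s x y (ℕ.suc-injective eq))

  subtreeEdges : edges t 1 ≡ relabel suc (edges t 0)
  subtreeEdges = edges-relabel suc t 0 1 λ _ → refl

  restEdges : forestEdges ts 0 (suc s) ≡ relabel restIndex (edges (node ts) 0)
  restEdges = forestEdges-relabel restIndex ts 0 1 (suc s) λ _ → refl

  adjacentᵇ-consTree : ∀ a b → adjacentᵇ (edges (node (t ∷ ts)) 0) a b ≡
    joinsᵇ a b (0 , 1) ∨ (adjacentᵇ (relabel suc (edges t 0)) a b ∨ adjacentᵇ (relabel restIndex (edges (node ts) 0)) a b)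
  adjacentᵇ-consTree a b = cong (joinsᵇ a b (0 , 1) ∨_) (≡.trans (adjacentᵇ-++ (edges t 1) _ a b)
    (cong₂ (λ es fs → adjacentᵇ es a b ∨ adjacentᵇ fs a b) subtreeEdges restEdges))

  subtree-avoids : ∀ x → Outside 1 s x → All (Avoids x) (relabel suc (edges t 0))
  subtree-avoids x outside = ≡.subst (All (Avoids x)) subtreeEdges (edges-avoids t 1 x outside)

  rest-avoids : ∀ x → 0 < x → x < suc s → All (Avoids x) (relabel restIndex (edges (node ts) 0))
  rest-avoids x 0<x x<1+s = ≡.subst (All (Avoids x)) restEdges
    (forestEdges-avoids ts 0 (suc s) x (λ { refl → ℕ.<-irrefl refl 0<x }) (inj₁ x<1+s))

  M-subtree : ∀ i j → i < s → M (suc i) (suc j) ≡ Mₜ i j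
  M-subtree i j i<s = cong (charEntry (i ≡ᵇ j)) (≡.trans (adjacentᵇ-consTree (suc i) (suc j))
    (≡.trans (cong₂ _∨_ (adjacentᵇ-relabel suc ℕ.suc-injective (edges t 0) i j)
                        (adjacentᵇ-avoidsˡ (suc j) (rest-avoids (suc i) (s≤s z≤n) (s≤s i<s))))
             (Bool.∨-identityʳ _)))

  M-rest : ∀ a b → M (restIndex a) (restIndex b) ≡ Mₛ a b
  M-rest a b = cong₂ charEntry (≡ᵇ-injective restIndex restIndex-injective a b)
    (≡.trans (adjacentᵇ-consTree (restIndex a) (restIndex b))
      (cong₂ _∨_ (not-rootEdge a b)
        (cong₂ _∨_ (adjacentᵇ-avoidsˡ (restIndex b) (subtree-avoids (restIndex a) (outside a)))
                   (adjacentᵇ-relabel restIndex restIndex-injective (edges (node ts) 0) a b))))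
    where
    not-rootEdge : ∀ a b → joinsᵇ (restIndex a) (restIndex b) (0 , 1) ≡ false
    not-rootEdge zero    zero    = refl
    not-rootEdge zero    (suc b) = refl
    not-rootEdge (suc a) zero    = refl
    not-rootEdge (suc a) (suc b) = refl
    outside : ∀ a → Outside 1 s (restIndex a)
    outside zero    = inj₁ (s≤s z≤n)
    outside (suc a) = inj₂ (s≤s (ℕ.m≤m+n s a))

  M-root-subtree : ∀ i → suc i < s → M 0 (suc (suc i)) ≋ []
  M-root-subtree i 1+i<s = ≋-trans (≡⇒≋ (cong (charEntry false) (≡.trans (adjacentᵇ-consTree 0 (suc (suc i)))
    (cong₂ _∨_ (adjacentᵇ-avoidsˡ (suc (suc i)) (subtree-avoids 0 (inj₁ (s≤s z≤n))))
               (adjacentᵇ-avoidsʳ 0 (rest-avoids (suc (suc i)) (s≤s z≤n) (s≤s 1+i<s)))))))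
    charEntry-off

  M-subtree-rest : ∀ i j → i < s → s ≤ j → M (suc i) (suc j) ≋ []
  M-subtree-rest i j i<s s≤j = ≋-trans (≡⇒≋ (cong₂ charEntry
    (≢⇒≡ᵇ-false (ℕ.<⇒≢ (ℕ.<-≤-trans i<s s≤j)))
    (≡.trans (adjacentᵇ-consTree (suc i) (suc j))
      (cong₂ _∨_ (adjacentᵇ-avoidsʳ (suc i) (subtree-avoids (suc j) (inj₂ (s≤s s≤j))))
                 (adjacentᵇ-avoidsˡ (suc j) (rest-avoids (suc i) (s≤s z≤n) (s≤s i<s)))))))
    charEntry-off

  M-rest-subtree : ∀ i j → s ≤ i → j < s → M (suc i) (suc j) ≋ []
  M-rest-subtree i j s≤i j<s =
    ≋-trans (≡⇒≋ (charMatrix-sym (edges (node (t ∷ ts)) 0) (suc i) (suc j))) (M-subtree-rest j i j<s s≤i)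

  φₜ πₜ πₛ : Poly
  φₜ = detℕ s Mₜ
  πₜ = detℕ (sizes cs) (minor 0 Mₜ)
  πₛ = detℕ q (minor 0 Mₛ)

  subtree-block : ∀ {N : Matrix} → (∀ i j → i < s → j < s → N i j ≡ M (suc i) (suc j)) → detℕ s N ≋ φₜ
  subtree-block N≡ = detℕ-cong s λ i j i<s j<s → ≡⇒≋ (≡.trans (N≡ i j i<s j<s) (M-subtree i j i<s))

  detℕ-minor₀ : detℕ (s + q) (minor 0 M) ≋ φₜ *ₚ πₛ
  detℕ-minor₀ = begin
    detℕ (s + q) (minor 0 M)
      ≈⟨ detℕ-topRowsInBlock s 0 q (minor 0 M) (λ { i j i<s (inj₂ s≤j) → M-subtree-rest i j i<s s≤j }) ⟩
    1ₚ *ₚ detℕ s (minor 0 M) *ₚ detℕ q (λ i j → M (suc (s + i)) (suc (s + j)))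
      ≈⟨ *ₚ-cong (*ₚ-congˡ 1ₚ (subtree-block λ _ _ _ _ → refl))
                 (detℕ-cong q λ i j _ _ → ≡⇒≋ (M-rest (suc i) (suc j))) ⟩
    1ₚ *ₚ φₜ *ₚ πₛ
      ≈⟨ *ₚ-congʳ πₛ (*ₚ-identityˡ φₜ) ⟩
    φₜ *ₚ πₛ ∎

  laplaceTerm₀ : laplaceTerm (s + q) M 0 ≋ X *ₚ (φₜ *ₚ πₛ)
  laplaceTerm₀ =
    *ₚ-cong (≋-trans (*ₚ-identityˡ (M 0 0)) (≋-trans (≡⇒≋ (M-rest 0 0)) (charMatrix-root ts))) detℕ-minor₀

  laplaceTerm₁ : laplaceTerm (s + q) M 1 ≋ negₚ (πₜ *ₚ πₛ)
  laplaceTerm₁ = begin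
    signₚ 1 *ₚ M 0 1 *ₚ detℕ (s + q) N
      ≈⟨ *ₚ-congˡ (signₚ 1 *ₚ M 0 1) (detℕ-topRowsInBlock s 0 q N rowsInBlock) ⟩
    signₚ 1 *ₚ M 0 1 *ₚ (1ₚ *ₚ detℕ s N *ₚ detℕ q (λ i j → N (s + i) (s + j)))
      ≈⟨ *ₚ-congˡ (signₚ 1 *ₚ M 0 1) (*ₚ-cong (*ₚ-congˡ 1ₚ top) bottom) ⟩
    signₚ 1 *ₚ M 0 1 *ₚ (1ₚ *ₚ (M 1 0 *ₚ πₜ) *ₚ πₛ)
      ≈⟨ signs πₜ πₛ ⟩
    negₚ (πₜ *ₚ πₛ) ∎
    where
    N = minor 1 M
    rowsInBlock : TopRowsInBlock s 0 N
    rowsInBlock i (suc j) i<s (inj₂ s≤1+j) = M-subtree-rest i (suc j) i<s s≤1+j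
    top : detℕ s N ≋ M 1 0 *ₚ πₜ
    top = ≋-trans (detℕ-column₀-top (sizes cs) N λ i i<n →
                    ≋-trans (≡⇒≋ (charMatrix-sym (edges (node (t ∷ ts)) 0) (suc (suc i)) 0)) (M-root-subtree i (s≤s i<n)))
                  (*ₚ-congˡ (M 1 0) (detℕ-cong (sizes cs) λ i j i<n _ → ≡⇒≋ (M-subtree (suc i) (suc j) (s≤s i<n))))
    bottom : detℕ q (λ i j → N (s + i) (s + j)) ≋ πₛ
    bottom = detℕ-cong q λ i j _ _ → ≡⇒≋ (M-rest (suc i) (suc j))
    signs : ∀ a b → negₚ 1ₚ *ₚ negₚ 1ₚ *ₚ (1ₚ *ₚ (negₚ 1ₚ *ₚ a) *ₚ b) ≋ negₚ (a *ₚ b)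
    signs = solve-∀ ℤ[X]-ring

  laplaceTerm-subtree : ∀ j → j < sizes cs → laplaceTerm (s + q) M (suc (suc j)) ≋ []
  laplaceTerm-subtree j j<n = laplaceTerm-≋[] (s + q) M (suc (suc j)) (M-root-subtree j (s≤s j<n))

  -- Split column 0 of the minor at row s: the part meeting the rows of t leaves the last
  -- rows in too few columns, the other part is block triangular.
  detℕ-minor-rest : ∀ k → k < q →
    detℕ (s + q) (minor (suc (s + k)) M) ≋ signₚ s *ₚ φₜ *ₚ detℕ q (minor (suc k) Mₛ)
  detℕ-minor-rest k k<q with q | k<q
  ... | suc q′ | _ = begin
    detℕ (s + suc q′) N
      ≈⟨ detℕ-column₀-split (sizes cs + suc q′) s N ⟩
    detℕ (s + suc q′) N₁ +ₚ detℕ (s + suc q′) N₂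
      ≈⟨ +ₚ-cong (detℕ-lowerLeftZero s q′ N₁ lowerLeftZero) (detℕ-topRowsInBlock s 1 q′ N₂ rowsInBlock) ⟩
    signₚ (1 * s) *ₚ detℕ s (λ i j → N₂ i (suc j)) *ₚ detℕ (suc q′) (λ i j → N₂ (s + i) (skipBlock 1 s j))
      ≈⟨ *ₚ-cong (*ₚ-cong (≡⇒≋ (cong signₚ (ℕ.*-identityˡ s)))
                          (subtree-block λ i j _ j<s → subtree-columns i j j<s))
                 (detℕ-cong (suc q′) λ i j _ _ → ≡⇒≋ (rest-columns i j)) ⟩
    signₚ s *ₚ φₜ *ₚ detℕ (suc q′) (minor (suc k) Mₛ) ∎
    where
    N = minor (suc (s + k)) M
    N₁ = topOfColumn₀ s N
    N₂ = bottomOfColumn₀ s N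
    subtree-columns : ∀ i j → j < s → N i (suc j) ≡ M (suc i) (suc j)
    subtree-columns i j j<s = cong (λ c → M (suc i) (suc c)) (punchInℕ-< (ℕ.<-≤-trans j<s (ℕ.m≤m+n s k)))
    lowerLeftZero : ∀ i j → s ≤ i → j ≤ s → N₁ i j ≋ []
    lowerLeftZero i zero    s≤i _   = topOfColumn₀-≋[] s N i s≤i
    lowerLeftZero i (suc j) s≤i j<s = ≋-trans (≡⇒≋ (subtree-columns i j j<s)) (M-rest-subtree i j s≤i j<s)
    rest-columns : ∀ i j → N₂ (s + i) (skipBlock 1 s j) ≡ minor (suc k) Mₛ i j
    rest-columns i zero    = ≡.trans (bottomOfColumn₀-≥ s N (s + i) (ℕ.m≤m+n s i)) (M-rest (suc i) 0)
    rest-columns i (suc j) =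
      ≡.trans (cong (λ c → M (suc (s + i)) (suc c)) (punchInℕ-+ s k j)) (M-rest (suc i) (suc (punchInℕ k j)))
    rowsInBlock : TopRowsInBlock s 1 N₂
    rowsInBlock i zero    i<s _ = bottomOfColumn₀-≋[] s N i i<s
    rowsInBlock i (suc j) i<s (inj₁ (s≤s ()))
    rowsInBlock i (suc j) i<s (inj₂ (s≤s s≤j)) = M-subtree-rest i _ i<s (ℕ.≤-trans s≤j (≤-punchInℕ (s + k) j))

  laplaceTerm-rest : ∀ k → k < q → laplaceTerm (s + q) M (suc (s + k)) ≋ φₜ *ₚ laplaceTerm q Mₛ (suc k)
  laplaceTerm-rest k k<q = begin
    signₚ (suc (s + k)) *ₚ M 0 (suc (s + k)) *ₚ detℕ (s + q) (minor (suc (s + k)) M)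
      ≈⟨ *ₚ-cong (*ₚ-cong sign-split (≡⇒≋ (M-rest 0 (suc k)))) (detℕ-minor-rest k k<q) ⟩
    signₚ s *ₚ signₚ (suc k) *ₚ Mₛ 0 (suc k) *ₚ (signₚ s *ₚ φₜ *ₚ D)
      ≈⟨ regroup (signₚ s) (signₚ (suc k)) (Mₛ 0 (suc k)) φₜ D ⟩
    signₚ s *ₚ signₚ s *ₚ (φₜ *ₚ (signₚ (suc k) *ₚ Mₛ 0 (suc k) *ₚ D))
      ≈⟨ ≋-trans (*ₚ-congʳ _ (signₚ-square s)) (*ₚ-identityˡ _) ⟩
    φₜ *ₚ laplaceTerm q Mₛ (suc k) ∎
    where
    D = detℕ q (minor (suc k) Mₛ)
    sign-split : signₚ (suc (s + k)) ≋ signₚ s *ₚ signₚ (suc k)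
    sign-split = ≋-trans (≡⇒≋ (cong signₚ (≡.sym (ℕ.+-suc s k)))) (signₚ-+ s (suc k))
    regroup : ∀ a b m f d → a *ₚ b *ₚ m *ₚ (a *ₚ f *ₚ d) ≋ a *ₚ a *ₚ (f *ₚ (b *ₚ m *ₚ d))
    regroup = solve-∀ ℤ[X]-ring

  -- Laplace expansion along the root row: the root's neighbours are the root of t
  -- (column 1) and the roots of ts, which lie outside the block of t.
  detℕ-consTree : detℕ (suc (s + q)) M ≋ φₜ *ₚ detℕ (suc q) Mₛ +ₚ negₚ (πₜ *ₚ πₛ)
  detℕ-consTree = begin
    L 0 +ₚ sumℕ (s + q) (λ j → L (suc j))
      ≈⟨ +ₚ-congˡ (L 0) (sumℕ-+ s q (λ j → L (suc j))) ⟩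
    L 0 +ₚ ((L 1 +ₚ sumℕ (sizes cs) (λ j → L (suc (suc j)))) +ₚ sumℕ q (λ k → L (suc (s + k))))
      ≈⟨ +ₚ-cong laplaceTerm₀ (+ₚ-cong (+ₚ-cong laplaceTerm₁ (sumℕ-≋[] (sizes cs) laplaceTerm-subtree))
                                        (sumℕ-cong q laplaceTerm-rest)) ⟩
    X *ₚ (φₜ *ₚ πₛ) +ₚ ((negₚ (πₜ *ₚ πₛ) +ₚ []) +ₚ sumℕ q (λ k → φₜ *ₚ Lₛ (suc k)))
      ≈⟨ +ₚ-congˡ (X *ₚ (φₜ *ₚ πₛ))
           (+ₚ-cong (+ₚ-identityʳ _) (≋-sym (sumℕ-*ₚˡ q (λ k → Lₛ (suc k)) φₜ))) ⟩
    X *ₚ (φₜ *ₚ πₛ) +ₚ (negₚ (πₜ *ₚ πₛ) +ₚ φₜ *ₚ sumℕ q (λ k → Lₛ (suc k)))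
      ≈⟨ regroup X φₜ πₛ πₜ (sumℕ q (λ k → Lₛ (suc k))) ⟩
    φₜ *ₚ (1ₚ *ₚ X *ₚ πₛ +ₚ sumℕ q (λ k → Lₛ (suc k))) +ₚ negₚ (πₜ *ₚ πₛ)
      ≈⟨ +ₚ-cong (*ₚ-congˡ φₜ (+ₚ-cong (*ₚ-congʳ πₛ (*ₚ-congˡ 1ₚ (≋-sym (charMatrix-root ts)))) ≋-refl))
                 ≋-refl ⟩
    φₜ *ₚ detℕ (suc q) Mₛ +ₚ negₚ (πₜ *ₚ πₛ) ∎
    where
    L = laplaceTerm (s + q) M
    Lₛ = laplaceTerm q Mₛ
    regroup : ∀ x f p p′ r →
      x *ₚ (f *ₚ p) +ₚ (negₚ (p′ *ₚ p) +ₚ f *ₚ r) ≋ f *ₚ (1ₚ *ₚ x *ₚ p +ₚ r) +ₚ negₚ (p′ *ₚ p)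
    regroup = solve-∀ ℤ[X]-ring

-- Edge deletion and joins

φ-forest : List RTree → Poly
φ-forest []       = 1ₚ
φ-forest (t ∷ ts) = φ t *ₚ φ-forest ts

-- the characteristic polynomial of the forest T − root
π : RTree → Poly
π (node ts) = φ-forest ts

detℕ-rootDeleted : ∀ ts → detℕ (sizes ts) (minor 0 (charMatrix (edges (node ts) 0))) ≋ φ-forest ts
detℕ-rootDeleted []            = ≋-refl
detℕ-rootDeleted (node cs ∷ ts) = ≋-trans (ConsTree.detℕ-minor₀ cs ts)
  (*ₚ-cong (≡⇒≋ (≡.sym (φ≡detℕ (node cs)))) (detℕ-rootDeleted ts))

φ-consTree : ∀ t ts → φ (node (t ∷ ts)) ≋ φ t *ₚ φ (node ts) +ₚ negₚ (π t *ₚ φ-forest ts)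
φ-consTree (node cs) ts = begin
  φ (node (node cs ∷ ts))
    ≡⟨ φ≡detℕ (node (node cs ∷ ts)) ⟩
  detℕ (suc (size (node cs) + sizes ts)) (charMatrix (edges (node (node cs ∷ ts)) 0))
    ≈⟨ ConsTree.detℕ-consTree cs ts ⟩
  φₜ *ₚ detℕ (size (node ts)) Mₛ +ₚ negₚ (πₜ *ₚ πₛ)
    ≈⟨ +ₚ-cong (*ₚ-cong (≡⇒≋ (≡.sym (φ≡detℕ (node cs)))) (≡⇒≋ (≡.sym (φ≡detℕ (node ts)))))
               (negₚ-cong (*ₚ-cong (detℕ-rootDeleted cs) (detℕ-rootDeleted ts))) ⟩
  φ (node cs) *ₚ φ (node ts) +ₚ negₚ (φ-forest cs *ₚ φ-forest ts) ∎
  where open ConsTree cs ts using (φₜ; πₜ; πₛ; Mₛ)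

φ-leaf : φ leaf ≋ X
φ-leaf = begin
  φ leaf                   ≡⟨ φ≡detℕ leaf ⟩
  1ₚ *ₚ M₀₀ *ₚ 1ₚ +ₚ []    ≈⟨ +ₚ-identityʳ _ ⟩
  1ₚ *ₚ M₀₀ *ₚ 1ₚ          ≈⟨ ≋-trans (*ₚ-comm (1ₚ *ₚ M₀₀) 1ₚ) (*ₚ-identityˡ (1ₚ *ₚ M₀₀)) ⟩
  1ₚ *ₚ M₀₀                ≈⟨ *ₚ-identityˡ M₀₀ ⟩
  M₀₀                      ≈⟨ charMatrix-root [] ⟩
  X                        ∎
  where M₀₀ = charMatrix [] 0 0

φ-forest-++ : ∀ ts us → φ-forest (ts ++ us) ≋ φ-forest ts *ₚ φ-forest us
φ-forest-++ []       us = ≋-sym (*ₚ-identityˡ (φ-forest us))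
φ-forest-++ (t ∷ ts) us =
  ≋-trans (*ₚ-congˡ (φ t) (φ-forest-++ ts us)) (≋-sym (*ₚ-assoc (φ t) (φ-forest ts) (φ-forest us)))

φ-forest-replicate : ∀ m t → φ-forest (replicate m t) ≡ φ t ^ₚ m
φ-forest-replicate zero    t = refl
φ-forest-replicate (suc m) t = cong (φ t *ₚ_) (φ-forest-replicate m t)

φ-node-++ : ∀ ts us → φ (node (ts ++ us)) ≋
  φ (node ts) *ₚ φ-forest us +ₚ φ-forest ts *ₚ φ (node us) +ₚ negₚ (X *ₚ φ-forest ts *ₚ φ-forest us)
φ-node-++ [] us = begin
  φ (node us)                                                       ≈⟨ expand (φ (node us)) (φ-forest us) X ⟩
  X *ₚ φ-forest us +ₚ 1ₚ *ₚ φ (node us) +ₚ negₚ (X *ₚ 1ₚ *ₚ φ-forest us)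
    ≈⟨ +ₚ-cong (+ₚ-cong (*ₚ-congʳ (φ-forest us) (≋-sym φ-leaf)) ≋-refl) ≋-refl ⟩
  φ leaf *ₚ φ-forest us +ₚ 1ₚ *ₚ φ (node us) +ₚ negₚ (X *ₚ 1ₚ *ₚ φ-forest us) ∎
  where
  expand : ∀ f p x → f ≋ x *ₚ p +ₚ 1ₚ *ₚ f +ₚ negₚ (x *ₚ 1ₚ *ₚ p)
  expand = solve-∀ ℤ[X]-ring
φ-node-++ (t ∷ ts) us = begin
  φ (node (t ∷ ts ++ us))
    ≈⟨ φ-consTree t (ts ++ us) ⟩
  φ t *ₚ φ (node (ts ++ us)) +ₚ negₚ (π t *ₚ φ-forest (ts ++ us))
    ≈⟨ +ₚ-cong (*ₚ-congˡ (φ t) (φ-node-++ ts us)) (negₚ-cong (*ₚ-congˡ (π t) (φ-forest-++ ts us))) ⟩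
  φ t *ₚ (φ (node ts) *ₚ φ-forest us +ₚ φ-forest ts *ₚ φ (node us) +ₚ negₚ (X *ₚ φ-forest ts *ₚ φ-forest us))
    +ₚ negₚ (π t *ₚ (φ-forest ts *ₚ φ-forest us))
    ≈⟨ regroup (φ t) (φ (node ts)) (φ-forest us) (φ-forest ts) (φ (node us)) X (π t) ⟩
  (φ t *ₚ φ (node ts) +ₚ negₚ (π t *ₚ φ-forest ts)) *ₚ φ-forest us +ₚ (φ t *ₚ φ-forest ts) *ₚ φ (node us)
    +ₚ negₚ (X *ₚ (φ t *ₚ φ-forest ts) *ₚ φ-forest us)
    ≈⟨ +ₚ-cong (+ₚ-cong (*ₚ-congʳ (φ-forest us) (≋-sym (φ-consTree t ts))) ≋-refl) ≋-refl ⟩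
  φ (node (t ∷ ts)) *ₚ φ-forest us +ₚ (φ t *ₚ φ-forest ts) *ₚ φ (node us)
    +ₚ negₚ (X *ₚ (φ t *ₚ φ-forest ts) *ₚ φ-forest us) ∎
  where
  regroup : ∀ f a pu pt fu x pc →
    f *ₚ (a *ₚ pu +ₚ pt *ₚ fu +ₚ negₚ (x *ₚ pt *ₚ pu)) +ₚ negₚ (pc *ₚ (pt *ₚ pu)) ≋
    (f *ₚ a +ₚ negₚ (pc *ₚ pt)) *ₚ pu +ₚ (f *ₚ pt) *ₚ fu +ₚ negₚ (x *ₚ (f *ₚ pt) *ₚ pu)
  regroup = solve-∀ ℤ[X]-ring

φ-node-replicate : ∀ m t →
  φ (node (replicate (suc m) t)) ≋ φ t ^ₚ m *ₚ (X *ₚ φ t +ₚ negₚ (constₚ (+ suc m) *ₚ π t))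
φ-node-replicate zero t = begin
  φ (node (t ∷ []))                          ≈⟨ φ-consTree t [] ⟩
  φ t *ₚ φ leaf +ₚ negₚ (π t *ₚ 1ₚ)          ≈⟨ +ₚ-cong (*ₚ-congˡ (φ t) φ-leaf) ≋-refl ⟩
  φ t *ₚ X +ₚ negₚ (π t *ₚ 1ₚ)               ≈⟨ rearrange (φ t) X (π t) ⟩
  1ₚ *ₚ (X *ₚ φ t +ₚ negₚ (1ₚ *ₚ π t))       ∎
  where
  rearrange : ∀ f x p → f *ₚ x +ₚ negₚ (p *ₚ 1ₚ) ≋ 1ₚ *ₚ (x *ₚ f +ₚ negₚ (1ₚ *ₚ p))
  rearrange = solve-∀ ℤ[X]-ring
φ-node-replicate (suc m) t = begin
  φ (node (t ∷ replicate (suc m) t))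
    ≈⟨ φ-consTree t (replicate (suc m) t) ⟩
  φ t *ₚ φ (node (replicate (suc m) t)) +ₚ negₚ (π t *ₚ φ-forest (replicate (suc m) t))
    ≈⟨ +ₚ-cong (*ₚ-congˡ (φ t) (φ-node-replicate m t))
               (≡⇒≋ (cong (λ p → negₚ (π t *ₚ p)) (φ-forest-replicate (suc m) t))) ⟩
  φ t *ₚ (φ t ^ₚ m *ₚ (X *ₚ φ t +ₚ negₚ (constₚ (+ suc m) *ₚ π t))) +ₚ negₚ (π t *ₚ (φ t *ₚ φ t ^ₚ m))
    ≈⟨ rearrange (φ t) (φ t ^ₚ m) X (constₚ (+ suc m)) (π t) ⟩
  φ t *ₚ φ t ^ₚ m *ₚ (X *ₚ φ t +ₚ negₚ ((1ₚ +ₚ constₚ (+ suc m)) *ₚ π t)) ∎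
  where
  rearrange : ∀ f fᵐ x c p → f *ₚ (fᵐ *ₚ (x *ₚ f +ₚ negₚ (c *ₚ p))) +ₚ negₚ (p *ₚ (f *ₚ fᵐ)) ≋
                             f *ₚ fᵐ *ₚ (x *ₚ f +ₚ negₚ ((1ₚ +ₚ c) *ₚ p))
  rearrange = solve-∀ ℤ[X]-ring

π-∼ : ∀ T₁ m T₂ → π (T₁ ∼ m · T₂) ≋ π T₁ *ₚ φ T₂ ^ₚ m
π-∼ (node cs) m T₂ =
  ≋-trans (φ-forest-++ cs (replicate m T₂)) (≡⇒≋ (cong (φ-forest cs *ₚ_) (φ-forest-replicate m T₂)))

φ-∼ : ∀ T₁ m T₂ →
  φ (T₁ ∼ suc m · T₂) ≋ φ T₂ ^ₚ m *ₚ (φ T₁ *ₚ φ T₂ +ₚ negₚ (constₚ (+ suc m) *ₚ π T₁ *ₚ π T₂))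
φ-∼ (node cs) m T₂ = begin
  φ (node (cs ++ replicate (suc m) T₂))
    ≈⟨ φ-node-++ cs (replicate (suc m) T₂) ⟩
  A *ₚ φ-forest (replicate (suc m) T₂) +ₚ a *ₚ φ (node (replicate (suc m) T₂))
    +ₚ negₚ (X *ₚ a *ₚ φ-forest (replicate (suc m) T₂))
    ≈⟨ +ₚ-cong (+ₚ-cong (≡⇒≋ (cong (A *ₚ_) (φ-forest-replicate (suc m) T₂)))
                        (*ₚ-congˡ a (φ-node-replicate m T₂)))
               (≡⇒≋ (cong (λ p → negₚ (X *ₚ a *ₚ p)) (φ-forest-replicate (suc m) T₂))) ⟩
  A *ₚ (B *ₚ Bᵐ) +ₚ a *ₚ (Bᵐ *ₚ (X *ₚ B +ₚ negₚ (c *ₚ b))) +ₚ negₚ (X *ₚ a *ₚ (B *ₚ Bᵐ))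
    ≈⟨ rearrange A B Bᵐ a b X c ⟩
  Bᵐ *ₚ (A *ₚ B +ₚ negₚ (c *ₚ a *ₚ b)) ∎
  where
  A = φ (node cs)
  a = φ-forest cs
  B = φ T₂
  Bᵐ = φ T₂ ^ₚ m
  b = π T₂
  c = constₚ (+ suc m)
  rearrange : ∀ A B Bᵐ a b x c →
    A *ₚ (B *ₚ Bᵐ) +ₚ a *ₚ (Bᵐ *ₚ (x *ₚ B +ₚ negₚ (c *ₚ b))) +ₚ negₚ (x *ₚ a *ₚ (B *ₚ Bᵐ)) ≋
    Bᵐ *ₚ (A *ₚ B +ₚ negₚ (c *ₚ a *ₚ b))
  rearrange = solve-∀ ℤ[X]-ring

module _ (T₁ T₂ : RTree) (a m : ℕ) (invariant : φ T₂ *ₚ φ T₁ ≋ x²- a *ₚ π T₂ *ₚ π T₁) where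

  private
    A = φ T₁
    B = φ T₂
    Bᵐ = φ T₂ ^ₚ m
    p₁ = π T₁
    p₂ = π T₂
    c = constₚ (+ suc m)
    cₐ = constₚ (+ a)

  ∼-invariant : φ (T₁ ∼ suc m · T₂) *ₚ φ T₂ ≋ x²- (a + suc m) *ₚ π (T₁ ∼ suc m · T₂) *ₚ π T₂
  ∼-invariant = begin
    φ (T₁ ∼ suc m · T₂) *ₚ B
      ≈⟨ *ₚ-congʳ B (φ-∼ T₁ m T₂) ⟩
    Bᵐ *ₚ (A *ₚ B +ₚ negₚ (c *ₚ p₁ *ₚ p₂)) *ₚ B
      ≈⟨ expand Bᵐ A B c p₁ p₂ ⟩
    B *ₚ Bᵐ *ₚ (B *ₚ A) +ₚ negₚ (c *ₚ (p₁ *ₚ (B *ₚ Bᵐ)) *ₚ p₂)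
      ≈⟨ +ₚ-cong (*ₚ-congˡ (B *ₚ Bᵐ) invariant) ≋-refl ⟩
    B *ₚ Bᵐ *ₚ (x²- a *ₚ p₂ *ₚ p₁) +ₚ negₚ (c *ₚ (p₁ *ₚ (B *ₚ Bᵐ)) *ₚ p₂)
      ≈⟨ collect B Bᵐ p₁ p₂ X cₐ c ⟩
    x²- (a + suc m) *ₚ (p₁ *ₚ (B *ₚ Bᵐ)) *ₚ p₂
      ≈⟨ *ₚ-congʳ p₂ (*ₚ-congˡ (x²- (a + suc m)) (≋-sym (π-∼ T₁ (suc m) T₂))) ⟩
    x²- (a + suc m) *ₚ π (T₁ ∼ suc m · T₂) *ₚ p₂ ∎
    where
    expand : ∀ Bᵐ A B c p₁ p₂ → Bᵐ *ₚ (A *ₚ B +ₚ negₚ (c *ₚ p₁ *ₚ p₂)) *ₚ B ≋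
                                 B *ₚ Bᵐ *ₚ (B *ₚ A) +ₚ negₚ (c *ₚ (p₁ *ₚ (B *ₚ Bᵐ)) *ₚ p₂)
    expand = solve-∀ ℤ[X]-ring
    collect : ∀ B Bᵐ p₁ p₂ x cₐ c →
      B *ₚ Bᵐ *ₚ ((x *ₚ x +ₚ negₚ cₐ) *ₚ p₂ *ₚ p₁) +ₚ negₚ (c *ₚ (p₁ *ₚ (B *ₚ Bᵐ)) *ₚ p₂) ≋
      (x *ₚ x +ₚ negₚ (cₐ +ₚ c)) *ₚ (p₁ *ₚ (B *ₚ Bᵐ)) *ₚ p₂
    collect = solve-∀ ℤ[X]-ring

  ∼-recurrence : φ (T₁ ∼ suc m · T₂) *ₚ x²- a ≋ φ T₂ ^ₚ suc m *ₚ φ T₁ *ₚ x²- (a + suc m)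
  ∼-recurrence = begin
    φ (T₁ ∼ suc m · T₂) *ₚ x²- a
      ≈⟨ *ₚ-congʳ (x²- a) (φ-∼ T₁ m T₂) ⟩
    Bᵐ *ₚ (A *ₚ B +ₚ negₚ (c *ₚ p₁ *ₚ p₂)) *ₚ x²- a
      ≈⟨ expand Bᵐ A B c p₁ p₂ X cₐ ⟩
    Bᵐ *ₚ A *ₚ B *ₚ x²- a +ₚ negₚ (c *ₚ Bᵐ *ₚ (x²- a *ₚ p₂ *ₚ p₁))
      ≈⟨ +ₚ-cong ≋-refl (negₚ-cong (*ₚ-congˡ (c *ₚ Bᵐ) (≋-sym invariant))) ⟩
    Bᵐ *ₚ A *ₚ B *ₚ x²- a +ₚ negₚ (c *ₚ Bᵐ *ₚ (B *ₚ A))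
      ≈⟨ collect Bᵐ A B c X cₐ ⟩
    B *ₚ Bᵐ *ₚ A *ₚ x²- (a + suc m) ∎
    where
    expand : ∀ Bᵐ A B c p₁ p₂ x cₐ →
      Bᵐ *ₚ (A *ₚ B +ₚ negₚ (c *ₚ p₁ *ₚ p₂)) *ₚ (x *ₚ x +ₚ negₚ cₐ) ≋
      Bᵐ *ₚ A *ₚ B *ₚ (x *ₚ x +ₚ negₚ cₐ) +ₚ negₚ (c *ₚ Bᵐ *ₚ ((x *ₚ x +ₚ negₚ cₐ) *ₚ p₂ *ₚ p₁))
    expand = solve-∀ ℤ[X]-ring
    collect : ∀ Bᵐ A B c x cₐ →
      Bᵐ *ₚ A *ₚ B *ₚ (x *ₚ x +ₚ negₚ cₐ) +ₚ negₚ (c *ₚ Bᵐ *ₚ (B *ₚ A)) ≋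
      B *ₚ Bᵐ *ₚ A *ₚ (x *ₚ x +ₚ negₚ (cₐ +ₚ c))
    collect = solve-∀ ℤ[X]-ring

∸-gap : ∀ {a b} → a < b → ∃[ m ] (b ∸ a ≡ suc m × a + suc m ≡ b)
∸-gap {a} {b} a<b = b ∸ suc a , b∸a≡ , a+gap≡b
  where
  a+gap≡b : a + suc (b ∸ suc a) ≡ b
  a+gap≡b = ≡.trans (ℕ.+-suc a (b ∸ suc a)) (ℕ.m+[n∸m]≡n a<b)
  b∸a≡ : b ∸ a ≡ suc (b ∸ suc a)
  b∸a≡ = ≡.trans (cong (_∸ a) (≡.sym a+gap≡b)) (ℕ.m+n∸m≡n a (suc (b ∸ suc a)))

C-∼ : ∀ r k {m} → r (suc (suc k)) ∸ r (suc k) ≡ suc m → C r (suc (suc k)) ≡ C r k ∼ suc m · C r (suc k)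
C-∼ r k d≡ = cong (λ d → C r k ∼ d · C r (suc k)) d≡

C-invariant : ∀ r k → 1 ≤ r 1 → (∀ i → 1 ≤ i → i ≤ k → r i < r (suc i)) →
  φ (C r (suc k)) *ₚ φ (C r k) ≋ x²- (r (suc k)) *ₚ π (C r (suc k)) *ₚ π (C r k)
C-invariant r zero 1≤r₁ _ with r 1 | 1≤r₁
... | suc m | _ = ∼-invariant leaf leaf 0 m leaf-invariant
  where
  leaf-invariant : φ leaf *ₚ φ leaf ≋ x²- 0 *ₚ 1ₚ *ₚ 1ₚ
  leaf-invariant = ≋-trans (*ₚ-cong φ-leaf φ-leaf) (square X)
    where
    square : ∀ x → x *ₚ x ≋ (x *ₚ x +ₚ negₚ (constₚ (+ 0))) *ₚ 1ₚ *ₚ 1ₚ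
    square = solve-∀ ℤ[X]-ring
C-invariant r (suc k) 1≤r₁ increasing with ∸-gap (increasing (suc k) (s≤s z≤n) ℕ.≤-refl)
... | m , d≡ , r₁+d≡r₂ = begin
  φ (C r (suc (suc k))) *ₚ B
    ≡⟨ cong (λ T → φ T *ₚ B) (C-∼ r k d≡) ⟩
  φ (C r k ∼ suc m · C r (suc k)) *ₚ B
    ≈⟨ ∼-invariant (C r k) (C r (suc k)) (r (suc k)) m
         (C-invariant r k 1≤r₁ λ i 1≤i i≤k → increasing i 1≤i (ℕ.m≤n⇒m≤1+n i≤k)) ⟩
  x²- (r (suc k) + suc m) *ₚ π (C r k ∼ suc m · C r (suc k)) *ₚ π (C r (suc k))
    ≡⟨ cong₂ (λ c T → x²- c *ₚ π T *ₚ π (C r (suc k))) r₁+d≡r₂ (≡.sym (C-∼ r k d≡)) ⟩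
  x²- (r (suc (suc k))) *ₚ π (C r (suc (suc k))) *ₚ π (C r (suc k)) ∎
  where B = φ (C r (suc k))

mainTheorem2 : (n : ℕ) → 2 ≤ n → (r : ℕ → ℕ) → 1 ≤ r 1 →
    (∀ i → 1 ≤ i → i < n → r i < r (suc i)) →
    φ (C r n) *ₚ x²- (r (n ∸ 1))
    ≈ₚ (φ (C r (n ∸ 1)) ^ₚ (r n ∸ r (n ∸ 1))) *ₚ φ (C r (n ∸ 2)) *ₚ x²- (r n)
mainTheorem2 (suc (suc k)) (s≤s (s≤s z≤n)) r 1≤r₁ increasing with ∸-gap (increasing (suc k) (s≤s z≤n) ℕ.≤-refl)
... | m , d≡ , r₁+d≡r₂ = coeff-≡ (begin
  φ (C r (suc (suc k))) *ₚ x²- (r (suc k))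
    ≡⟨ cong (λ T → φ T *ₚ x²- (r (suc k))) (C-∼ r k d≡) ⟩
  φ (C r k ∼ suc m · C r (suc k)) *ₚ x²- (r (suc k))
    ≈⟨ ∼-recurrence (C r k) (C r (suc k)) (r (suc k)) m
         (C-invariant r k 1≤r₁ λ i 1≤i i≤k → increasing i 1≤i (s≤s (ℕ.m≤n⇒m≤1+n i≤k))) ⟩
  φ (C r (suc k)) ^ₚ suc m *ₚ φ (C r k) *ₚ x²- (r (suc k) + suc m)
    ≡⟨ cong₂ (λ d c → φ (C r (suc k)) ^ₚ d *ₚ φ (C r k) *ₚ x²- c) (≡.sym d≡) r₁+d≡r₂ ⟩
  φ (C r (suc k)) ^ₚ (r (suc (suc k)) ∸ r (suc k)) *ₚ φ (C r k) *ₚ x²- (r (suc (suc k))) ∎)
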